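{- Let $n,p$ be positive coprime integers, $x\in\mathfrak D_{n,p}$, and $y=\varphi^{ -1}(\varphi(x)')$. Then $d_{n+1-j,n+1-i}(y)=d_{i,j}(x)$ for all $i,j\in[n]$ with $i<j$; i.e. the codinv tableau of $x$ is the transpose of the codinv tableau of $y$.
   Context: A rational Dyck path is a lattice path from $(0,0)$ with $n$ North steps $(0,1)$ and $p$ East steps $(1,0)$ never going below the line of slope $n/p$ through the origin; $\mathfrak D_{n,p}$ is their set. The unit square with bottom-right corner $(i,j)$ has label $\ell_{i,j}=jp-in$; each step gets the label of its starting point. Let $\ell_1<\dots<\ell_n$ be the labels of the North steps of $x$ and $H(x)$ the set of positive labels of unit squares lying below $x$ (between $x$ and the diagonal). The codinv tableau is $d_{i,j}(x)=\#\{h\in H(x):\ell_i<h<\ell_i+p,\ h\equiv\ell_j\pmod n\}$. For a finite set $H$ of positive integers there is a unique partition whose first-column cells have hook lengths exactly $H$; $\varphi(x)$ is the partition with first-column hook length set $H(x)$, and $\varphi$ is a bijection from $\mathfrak D_{n,p}$ onto the set of $n,p$-cores (partitions with no hook length $n$ or $p$) (Anderson). $\lambda'$ denotes the conjugate partition. -}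

module Defs where

open import Data.Bool using (Bool; true; false; _∧_)
open import Data.Nat as ℕ using (ℕ; zero; suc; _∸_; _⊔_)
open import Data.Nat.Divisibility as ℕD using ()
open import Data.Integer as ℤ using (ℤ; +_; _-_)
open import Data.Integer.Properties as ℤP using ()
open import Data.Integer.Divisibility as ℤD using ()
open import Data.List using (List; []; _∷_; length; map; filterᵇ; concatMap; upTo; foldr; head)
open import Data.List.Membership.Propositional using (_∈_)
open import Data.List.Relation.Unary.All using (All)
open import Data.List.Relation.Unary.Linked using (Linked)
open import Data.List.Sort.MergeSort ℤP.≤-decTotalOrder using (sort)
open import Data.Product using (_×_; _,_)
open import Relation.Binary.PropositionalEquality using (_≡_)
open import Relation.Nullary using (does)
open import Function.Bundles using (_⇔_)

data Step : Set where
  N E : Step          -- N = (0,1), E = (1,0)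

#N #E : List Step → ℕ
#N []       = 0
#N (N ∷ w)  = suc (#N w)
#N (E ∷ w)  = #N w
#E []       = 0
#E (N ∷ w)  = #E w
#E (E ∷ w)  = suc (#E w)

stepsFrom : ℕ → ℕ → List Step → List (Step × ℕ × ℕ)
stepsFrom i j []      = []
stepsFrom i j (N ∷ w) = (N , i , j) ∷ stepsFrom i (suc j) w
stepsFrom i j (E ∷ w) = (E , i , j) ∷ stepsFrom (suc i) j w

steps : List Step → List (Step × ℕ × ℕ)
steps = stepsFrom 0 0

-- label of the point / unit square with bottom-right corner (i , j):  j p - i n
label : (n p : ℕ) → ℕ → ℕ → ℤ
label n p i j = + (j ℕ.* p) - + (i ℕ.* n)

-- Every starting point of a step (and hence every lattice point of the
-- path, the endpoint (p , n) lying on the line) is weakly above the line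
-- of slope n/p through the origin:  i n ≤ j p.
NotBelow : (n p : ℕ) → List Step → Set
NotBelow n p w = All (λ { (_ , i , j) → i ℕ.* n ℕ.≤ j ℕ.* p }) (steps w)

IsRatDyck : (n p : ℕ) → List Step → Set
IsRatDyck n p w = (#N w ≡ n) × (#E w ≡ p) × NotBelow n p w

northLabel : (n p : ℕ) → Step × ℕ × ℕ → List ℤ
northLabel n p (N , i , j) = label n p i j ∷ []
northLabel n p (E , i , j) = []

northLabels : (n p : ℕ) → List Step → List ℤ
northLabels n p w = sort (concatMap (northLabel n p) (steps w))

-- 1-based lookup with default 0
atℤ : List ℤ → ℕ → ℤ
atℤ []       _             = + 0
atℤ (x ∷ xs) 1             = x
atℤ (x ∷ xs) (suc (suc k)) = atℤ xs (suc k)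
atℤ (x ∷ xs) zero          = + 0

ℓ : (n p : ℕ) → List Step → ℕ → ℤ
ℓ n p w k = atℤ (northLabels n p w) k

-- H(x): positive labels of unit squares below x.
-- An East step starting at (i , j) covers the column [i , i+1]; the unit
-- squares below the path in that column have bottom-right corners
-- (i+1 , r) for r < j.

colLabels : (n p : ℕ) → Step × ℕ × ℕ → List ℤ
colLabels n p (N , i , j) = []
colLabels n p (E , i , j) =
  filterᵇ (λ h → does (+ 0 ℤ.<? h)) (map (λ r → label n p (suc i) r) (upTo j))

H : (n p : ℕ) → List Step → List ℤ
H n p w = concatMap (colLabels n p) (steps w)

-- codinv tableau
-- d_{i,j}(x) = #{ h ∈ H(x) : ℓ_i < h < ℓ_i + p , h ≡ ℓ_j (mod n) }
-- (congruence mod n is  + n ∣ h - ℓ_j  in ℤ, i.e. n ∣ ∣ h - ℓ_j ∣)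

d : (n p : ℕ) → List Step → ℕ → ℕ → ℕ
d n p w i j = length (filterᵇ cond (H n p w))
  where
  cond : ℤ → Bool
  cond h = does (ℓ n p w i ℤ.<? h)
         ∧ does (h ℤ.<? ℓ n p w i ℤ.+ + p)
         ∧ does (n ℕD.∣? ℤ.∣ h - ℓ n p w j ∣)

IsPartition : List ℕ → Set
IsPartition μ = All (λ a → 0 ℕ.< a) μ × Linked (λ a b → b ℕ.≤ a) μ

-- 0-based lookup with default 0
at : List ℕ → ℕ → ℕ
at []       _       = 0
at (x ∷ xs) zero    = x
at (x ∷ xs) (suc k) = at xs k

conj : List ℕ → List ℕ
conj μ = map (λ c → length (filterᵇ (λ a → does (suc c ℕ.≤? a)) μ))
             (upTo (foldr _⊔_ 0 μ))

-- hook length of the cell in row r+1, column c+1 (0-based r, c):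
-- arm + leg + 1
hook : List ℕ → ℕ → ℕ → ℕ
hook μ r c = (at μ r ∸ suc c) ℕ.+ (at (conj μ) c ∸ suc r) ℕ.+ 1

firstColHooks : List ℕ → List ℕ
firstColHooks μ = map (λ r → hook μ r 0) (upTo (length μ))

HasFirstColHooks : List ℕ → List ℤ → Set
HasFirstColHooks μ Hs = ∀ (h : ℤ) → (h ∈ map +_ (firstColHooks μ)) ⇔ (h ∈ Hs)

-- φ(x) ≡ λ  (φ(x) is the partition whose first-column hook set is H(x))
Φ : (n p : ℕ) → List Step → List ℕ → Set
Φ n p w μ = IsPartition μ × HasFirstColHooks μ (H n p w)

-- The North labels of a rational Dyck path x are the least elements, in their residue classes
-- mod n, of ℕ ∖ H(x), and H(x) consists of the positive h lying below the North label of their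
-- class. Hence d_{i,j}(x) only depends on δ = ℓ_j - ℓ_i: it counts the s ≥ 1 with s n < δ < s n + p.
-- If H(x) and H(y) are the first-column hook sets of λ and λ', then H(y) = {1, …, M} ∖ (M - H(x))
-- for the largest hook M of λ. This turns the North labels of y into the reflections M + n - ℓ of
-- those of x, so ℓ_{n+1-k}(y) = M + n - ℓ_k(x), and the gaps δ, hence the counts, are transposed.

module Submission where

open import Defs
open import Data.Nat using (ℕ; _≤_; _<_; _∸_; _+_)
open import Data.Nat.Coprimality using (Coprime)
open import Data.List using (List)
open import Relation.Binary.PropositionalEquality using (_≡_)

open import Data.Bool using (Bool; T; _∧_)
open import Data.Bool.Properties using (T-∧)
open import Data.Empty using (⊥)
open import Data.Integer as ℤ using (ℤ; +_; _-_)
import Data.Integer.Coprimality as ℤ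
open import Data.Integer.DivMod using (_%ℕ_; _/ℕ_; n%ℕd<d; a≡a%ℕn+[a/ℕn]*n)
open import Data.Integer.Divisibility.Signed
  using (_∣_; divides; ∣⇒∣ᵤ; ∣ᵤ⇒∣; ∣m+n∣n⇒∣m; ∣m∣n⇒∣m+n; ∣m∣n⇒∣m-n; ∣m⇒∣m*n; ∣n⇒∣m*n; ∣m⇒∣-m; ∣-refl)
import Data.Integer.Properties as ℤ
open import Algebra.Properties.AbelianGroup ℤ.+-0-abelianGroup using ()
  renaming (∙-cancelˡ to +-cancelˡ; ∙-cancelʳ to +-cancelʳ)
open import Data.Integer.Tactic.RingSolver using (solve-∀)
open import Data.List using ([]; _∷_; [_]; _++_; length; map; reverse; concatMap; upTo; applyUpTo; foldr; filter; filterᵇ)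
open import Data.List.Membership.DecPropositional ℤ._≟_ using (_∈?_)
open import Data.List.Membership.Propositional using (_∈_; _∉_; find; lose)
open import Data.List.Membership.Propositional.Properties
  using (∈-concatMap⁺; ∈-concatMap⁻; ∈-filter⁺; ∈-filter⁻; ∈-map⁺; ∈-map⁻; ∈-upTo⁺; ∈-upTo⁻)
open import Data.List.Membership.Propositional.Properties.WithK using (unique∧set⇒bag)
import Data.List.Properties as List
open import Data.List.Relation.Binary.BagAndSetEquality using (_∼[_]_; set; ∼bag⇒↭)
open import Data.List.Relation.Binary.Permutation.Propositional
  using (_↭_; ↭-sym; ↭⇒↭ₛ; module PermutationReasoning)
open import Data.List.Relation.Binary.Permutation.Propositional.Properties
  using (↭-length; ↭-reverse; ∈-resp-↭) renaming (map⁺ to ↭-map⁺)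
open import Data.List.Relation.Binary.Pointwise using (Pointwise-≡⇒≡)
open import Data.List.Relation.Unary.All as All using (All)
open import Data.List.Relation.Unary.AllPairs as AllPairs using (AllPairs; []; _∷_)
import Data.List.Relation.Unary.AllPairs.Properties as AllPairs
open import Data.List.Relation.Unary.Any using (here; there)
import Data.List.Relation.Unary.Any.Properties as Any
open import Data.List.Relation.Unary.Linked as Linked using (Linked)
open import Data.List.Relation.Unary.Linked.Properties using (Linked⇒AllPairs)
open import Data.List.Relation.Unary.Sorted.TotalOrder ℤ.≤-totalOrder using (Sorted)
open import Data.List.Relation.Unary.Sorted.TotalOrder.Properties using (↗↭↗⇒≋; AllPairs⇒Sorted; Sorted⇒AllPairs)
open import Data.List.Relation.Unary.Unique.Propositional using (Unique)
import Data.List.Relation.Unary.Unique.Propositional.Properties as Unique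
open import Data.List.Sort.Base using (SortingAlgorithm)
open import Data.List.Sort.MergeSort ℤ.≤-decTotalOrder using (sort; mergeSort)
open import Data.Nat as ℕ using (zero; suc; z≤n; s≤s; _*_; _⊔_)
open import Data.Nat.Coprimality using (coprime-Bézout)
import Data.Nat.Divisibility as ℕ
open import Data.Nat.GCD using (module Bézout)
import Data.Nat.Properties as ℕ
open import Data.Nat.Tactic.RingSolver using () renaming (solve-∀ to ℕ-solve-∀)
open import Data.Product using (_×_; _,_; ∃-syntax; proj₁; proj₂)
open import Data.Sum as Sum using (_⊎_; inj₁; inj₂)
open import Function using (flip; _∘_)
open import Function.Bundles using (Equivalence; mk⇔; _⇔_)
open import Relation.Binary.Core using (Rel)
open import Relation.Binary.Definitions using (tri<; tri≈; tri>)
open import Relation.Binary.PropositionalEquality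
  using (_≢_; refl; sym; trans; cong; cong₂; subst; subst₂; module ≡-Reasoning)
open import Relation.Nullary using (¬_; Dec; yes; no; contradiction; does)
open import Relation.Nullary.Decidable using (T?; _×-dec_)

open SortingAlgorithm mergeSort using (sort-↭; sort-↗)

-- Defs filters with does; the library's toWitness and fromWitness are stated for isYes.
T-does⇒ : ∀ {a} {A : Set a} (a? : Dec A) → T (does a?) → A
T-does⇒ (yes a) _ = a

⇒T-does : ∀ {a} {A : Set a} (a? : Dec A) → A → T (does a?)
⇒T-does (yes _) _ = _
⇒T-does (no ¬a) a = contradiction a ¬a

unique-set⇒↭ : ∀ {a} {A : Set a} {xs ys : List A} → Unique xs → Unique ys → xs ∼[ set ] ys → xs ↭ ys
unique-set⇒↭ uxs uys xs≈ys = ∼bag⇒↭ (unique∧set⇒bag uxs uys xs≈ys)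

sorted-↭⇒≡ : ∀ {xs ys} → Sorted xs → Sorted ys → xs ↭ ys → xs ≡ ys
sorted-↭⇒≡ xs↗ ys↗ xs↭ys = Pointwise-≡⇒≡ (↗↭↗⇒≋ ℤ.≤-totalOrder xs↗ ys↗ (↭⇒↭ₛ xs↭ys))

AllPairs-reverse⁺ : ∀ {a r} {A : Set a} {R : Rel A r} {xs} → AllPairs R xs → AllPairs (flip R) (reverse xs)
AllPairs-reverse⁺ {xs = []} [] = []
AllPairs-reverse⁺ {xs = x ∷ xs} (x~xs ∷ pxs) rewrite List.unfold-reverse x xs =
  AllPairs.++⁺ (AllPairs-reverse⁺ pxs) (All.[] ∷ []) (All.tabulate λ m → All.lookup x~xs (Any.reverse⁻ m) All.∷ All.[])

atℤ-∈ : ∀ xs {k} → k < length xs → atℤ xs (suc k) ∈ xs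
atℤ-∈ (x ∷ xs) {zero}  _         = here refl
atℤ-∈ (x ∷ xs) {suc k} (s≤s k<) = there (atℤ-∈ xs k<)

atℤ-map : ∀ f xs {k} → k < length xs → atℤ (map f xs) (suc k) ≡ f (atℤ xs (suc k))
atℤ-map f (x ∷ xs) {zero}  _         = refl
atℤ-map f (x ∷ xs) {suc k} (s≤s k<) = atℤ-map f xs k<

atℤ-++ˡ : ∀ xs ys {k} → k < length xs → atℤ (xs ++ ys) (suc k) ≡ atℤ xs (suc k)
atℤ-++ˡ (x ∷ xs) ys {zero}  _         = refl
atℤ-++ˡ (x ∷ xs) ys {suc k} (s≤s k<) = atℤ-++ˡ xs ys k<

atℤ-∷ʳ-length : ∀ xs y → atℤ (xs ++ [ y ]) (suc (length xs)) ≡ y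
atℤ-∷ʳ-length []       y = refl
atℤ-∷ʳ-length (x ∷ xs) y = atℤ-∷ʳ-length xs y

atℤ-reverse : ∀ xs {i j} → suc (i + j) ≡ length xs → atℤ (reverse xs) (suc i) ≡ atℤ xs (suc j)
atℤ-reverse (x ∷ xs) {i} {zero} eq rewrite List.unfold-reverse x xs =
  trans (cong (λ k → atℤ (reverse xs ++ [ x ]) (suc k)) i≡) (atℤ-∷ʳ-length (reverse xs) x)
  where
  i≡ : i ≡ length (reverse xs)
  i≡ = trans (sym (ℕ.+-identityʳ i)) (trans (ℕ.suc-injective eq) (sym (List.length-reverse xs)))
atℤ-reverse (x ∷ xs) {i} {suc j} eq rewrite List.unfold-reverse x xs =
  trans (atℤ-++ˡ (reverse xs) [ x ] i<) (atℤ-reverse xs i+j≡)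
  where
  i+j≡ : suc (i + j) ≡ length xs
  i+j≡ = trans (sym (ℕ.+-suc i j)) (ℕ.suc-injective eq)
  i< : i < length (reverse xs)
  i< = subst (i <_) (sym (List.length-reverse xs)) (subst (i <_) i+j≡ (s≤s (ℕ.m≤m+n i j)))

atℤ-mono : ∀ {xs i j} → AllPairs ℤ._≤_ xs → i ≤ j → j < length xs → atℤ xs (suc i) ℤ.≤ atℤ xs (suc j)
atℤ-mono {x ∷ xs} {zero}  {zero}  _            _         _        = ℤ.≤-refl
atℤ-mono {x ∷ xs} {zero}  {suc j} (x≤xs ∷ _)   _         (s≤s j<) = All.lookup x≤xs (atℤ-∈ xs j<)
atℤ-mono {x ∷ xs} {suc i} {suc j} (_ ∷ xs≤)    (s≤s i≤j) (s≤s j<) = atℤ-mono xs≤ i≤j j<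

<⇒0<-diff : ∀ {i j} → i ℤ.< j → + 0 ℤ.< j - i
<⇒0<-diff {i} {j} i<j = subst (ℤ._< j - i) (ℤ.+-inverseʳ i) (ℤ.+-monoˡ-< (ℤ.- i) i<j)

0<-diff⇒< : ∀ {i j} → + 0 ℤ.< j - i → i ℤ.< j
0<-diff⇒< {i} {j} 0<j-i = subst₂ ℤ._<_ (ℤ.+-identityˡ i) (j-i+i≡j i j) (ℤ.+-monoˡ-< i 0<j-i)
  where
  j-i+i≡j : ∀ i j → (j - i) ℤ.+ i ≡ j
  j-i+i≡j = solve-∀

<-from-diff : ∀ {x y a b} → a ℤ.< b → y - x ≡ b - a → x ℤ.< y
<-from-diff a<b eq = 0<-diff⇒< (subst (+ 0 ℤ.<_) (sym eq) (<⇒0<-diff a<b))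

≤-from-diff : ∀ {x y a b} → a ℤ.≤ b → y - x ≡ b - a → x ℤ.≤ y
≤-from-diff a≤b eq = ℤ.0≤i-j⇒j≤i (subst (+ 0 ℤ.≤_) (sym eq) (ℤ.i≤j⇒0≤j-i a≤b))

positive-multiple : ∀ {n z} .{{_ : ℕ.NonZero n}} → + 0 ℤ.< z → + n ∣ z → ∃[ s ] z ≡ + (suc s * n)
positive-multiple {n} {z} z>0 n∣z with ∣⇒∣ᵤ n∣z
... | ℕ.divides zero    ∣z∣≡0   = contradiction (sym (ℤ.∣i∣≡0⇒i≡0 ∣z∣≡0)) (ℤ.<⇒≢ z>0)
... | ℕ.divides (suc s) ∣z∣≡sn = s , trans (sym (ℤ.0≤i⇒+∣i∣≡i (ℤ.<⇒≤ z>0))) (cong +_ ∣z∣≡sn)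

multiple-≥ : ∀ {n z} .{{_ : ℕ.NonZero n}} → + 0 ℤ.< z → + n ∣ z → + n ℤ.≤ z
multiple-≥ {n} z>0 n∣z with s , refl ← positive-multiple z>0 n∣z = ℤ.+≤+ (ℕ.m≤m+n n (s * n))

multiple-below⇒≡0 : ∀ {n m} → n ℕ.∣ m → m < n → m ≡ 0
multiple-below⇒≡0 {m = zero}  _   _   = refl
multiple-below⇒≡0 {m = suc m} n∣m m<n = contradiction n∣m (ℕ.>⇒∤ m<n)

private
  ↑-+-* : ∀ a b c d e → a + b * c ≡ d * e → + a ℤ.+ + b ℤ.* + c ≡ + d ℤ.* + e
  ↑-+-* a b c d e eq = begin
    + a ℤ.+ + b ℤ.* + c ≡⟨ cong (ℤ._+_ (+ a)) (ℤ.pos-* b c) ⟨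
    + a ℤ.+ + (b * c)   ≡⟨ ℤ.pos-+ a (b * c) ⟨
    + (a + b * c)       ≡⟨ cong +_ eq ⟩
    + (d * e)           ≡⟨ ℤ.pos-* d e ⟩
    + d ℤ.* + e         ∎
    where open ≡-Reasoning

p-invertible-mod-n : ∀ {n p} → Coprime n p → ∃[ u ] + n ∣ u ℤ.* + p - + 1
p-invertible-mod-n {n} {p} n⊥p with coprime-Bézout n⊥p
... | Bézout.+- x y 1+yp≡xn = ℤ.- + y , divides (ℤ.- + x) (begin
  ℤ.- + y ℤ.* + p - + 1      ≡⟨ lemma (+ y) (+ p) ⟩
  ℤ.- (+ 1 ℤ.+ + y ℤ.* + p) ≡⟨ cong ℤ.-_ (↑-+-* 1 y p x n 1+yp≡xn) ⟩
  ℤ.- (+ x ℤ.* + n)         ≡⟨ ℤ.neg-distribˡ-* (+ x) (+ n) ⟩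
  ℤ.- + x ℤ.* + n           ∎)
  where
  open ≡-Reasoning
  lemma : ∀ y p → ℤ.- y ℤ.* p - + 1 ≡ ℤ.- (+ 1 ℤ.+ y ℤ.* p)
  lemma = solve-∀
... | Bézout.-+ x y 1+xn≡yp = + y , divides (+ x) (begin
  + y ℤ.* + p - + 1             ≡⟨ cong (_- + 1) (↑-+-* 1 x n y p 1+xn≡yp) ⟨
  + 1 ℤ.+ + x ℤ.* + n - + 1     ≡⟨ lemma (+ x ℤ.* + n) ⟩
  + x ℤ.* + n                   ∎)
  where
  open ≡-Reasoning
  lemma : ∀ a → + 1 ℤ.+ a - + 1 ≡ a
  lemma = solve-∀

label-diff : ∀ n p i j i′ j′ → label n p i j - label n p i′ j′ ≡ (+ j - + j′) ℤ.* + p ℤ.+ (+ i′ - + i) ℤ.* + n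
label-diff n p i j i′ j′
  rewrite ℤ.pos-* j p | ℤ.pos-* i n | ℤ.pos-* j′ p | ℤ.pos-* i′ n = lemma (+ j) (+ p) (+ i) (+ n) (+ j′) (+ i′)
  where
  lemma : ∀ a b c d e f → (a ℤ.* b - c ℤ.* d) - (e ℤ.* b - f ℤ.* d) ≡ (a - e) ℤ.* b ℤ.+ (f - c) ℤ.* d
  lemma = solve-∀

coprime-heights-≡ : ∀ {n p j j′} → Coprime n p → j < n → j′ < n → + n ∣ (+ j - + j′) ℤ.* + p → j ≡ j′
coprime-heights-≡ {n} {p} {j} {j′} n⊥p j<n j′<n n∣ =
  ℤ.+-injective (ℤ.i-j≡0⇒i≡j (+ j) (+ j′) (ℤ.∣i∣≡0⇒i≡0 (multiple-below⇒≡0 n∣j-j′ j-j′<n)))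
  where
  n∣j-j′ : n ℕ.∣ ℤ.∣ + j - + j′ ∣
  n∣j-j′ = ℤ.coprime-divisor (+ n) (+ p) (+ j - + j′) n⊥p
             (subst (n ℕ.∣_) (cong ℤ.∣_∣ (ℤ.*-comm (+ j - + j′) (+ p))) (∣⇒∣ᵤ n∣))
  j-j′<n : ℤ.∣ + j - + j′ ∣ < n
  j-j′<n rewrite ℤ.[+m]-[+n]≡m⊖n j j′ = ℕ.≤-<-trans (ℤ.∣m⊝n∣≤m⊔n j j′) (ℕ.⊔-lub j<n j′<n)

label-congruent⇒height-≡ : ∀ {n p i j i′ j′} → Coprime n p → j < n → j′ < n →
                            + n ∣ (label n p i j - label n p i′ j′) → j ≡ j′
label-congruent⇒height-≡ {n} {p} {i} {j} {i′} {j′} n⊥p j<n j′<n n∣ =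
  coprime-heights-≡ n⊥p j<n j′<n
    (∣m+n∣n⇒∣m (subst (+ n ∣_) (label-diff n p i j i′ j′) n∣) (∣n⇒∣m*n (+ i′ - + i) ∣-refl))

label-injective : ∀ {n p i j i′ j′} .{{_ : ℕ.NonZero n}} → Coprime n p → j < n → j′ < n →
                  label n p i j ≡ label n p i′ j′ → i ≡ i′ × j ≡ j′
label-injective {n} {p} {i} {j} {i′} {j′} n⊥p j<n j′<n eq = i≡i′ , j≡j′
  where
  j≡j′ : j ≡ j′
  j≡j′ = label-congruent⇒height-≡ {i = i} {i′ = i′} n⊥p j<n j′<n
           (subst (+ n ∣_) (sym (trans (cong (_- label n p i′ j′) eq) (ℤ.+-inverseʳ (label n p i′ j′)))) (divides (+ 0) refl))
  i≡i′ : i ≡ i′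
  i≡i′ = ℕ.*-cancelʳ-≡ i i′ n (ℤ.+-injective (ℤ.neg-injective
           (+-cancelˡ (+ (j * p)) _ _ (subst (λ k → label n p i j ≡ + (k * p) - + (i′ * n)) (sym j≡j′) eq))))

label-injectiveʳ : ∀ {n p i j j′} .{{_ : ℕ.NonZero p}} → label n p i j ≡ label n p i j′ → j ≡ j′
label-injectiveʳ {n} {p} {i} {j} {j′} eq = ℕ.*-cancelʳ-≡ j j′ p (ℤ.+-injective (+-cancelʳ (ℤ.- + (i * n)) _ _ eq))

label-nonneg : ∀ {n p i j} → i * n ≤ j * p → + 0 ℤ.≤ label n p i j
label-nonneg i*n≤j*p = ℤ.i≤j⇒0≤j-i (ℤ.+≤+ i*n≤j*p)

label-antitone-column : ∀ {n p a b} r .{{_ : ℕ.NonZero n}} → a < b → label n p b r ℤ.< label n p a r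
label-antitone-column {n} {p} r a<b = ℤ.+-monoʳ-< (+ (r * p)) (ℤ.neg-mono-< (ℤ.+<+ (ℕ.*-monoˡ-< n a<b)))

label-shift : ∀ n p i j s → label n p i j - + (s * n) ≡ label n p (i + s) j
label-shift n p i j s rewrite ℤ.pos-* (i + s) n | ℤ.pos-+ i s | ℤ.pos-* i n | ℤ.pos-* s n =
  lemma (+ (j * p)) (+ i) (+ s) (+ n)
  where
  lemma : ∀ a b c d → (a - b ℤ.* d) - c ℤ.* d ≡ a - (b ℤ.+ c) ℤ.* d
  lemma = solve-∀

-- Lattice paths

stepsFrom-start≤ : ∀ {s i j} i₀ j₀ w → (s , i , j) ∈ stepsFrom i₀ j₀ w → i₀ ≤ i × j₀ ≤ j
stepsFrom-start≤ i₀ j₀ (N ∷ w) (here refl) = ℕ.≤-refl , ℕ.≤-refl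
stepsFrom-start≤ i₀ j₀ (N ∷ w) (there m) =
  let i₀≤i , j₀<j = stepsFrom-start≤ i₀ (suc j₀) w m in i₀≤i , ℕ.<⇒≤ j₀<j
stepsFrom-start≤ i₀ j₀ (E ∷ w) (here refl) = ℕ.≤-refl , ℕ.≤-refl
stepsFrom-start≤ i₀ j₀ (E ∷ w) (there m) =
  let i₀<i , j₀≤j = stepsFrom-start≤ (suc i₀) j₀ w m in ℕ.<⇒≤ i₀<i , j₀≤j

stepsFrom-height≤ : ∀ {s i j} i₀ j₀ w → (s , i , j) ∈ stepsFrom i₀ j₀ w → j ≤ j₀ + #N w
stepsFrom-height≤ i₀ j₀ (N ∷ w) (here refl) = ℕ.m≤m+n j₀ _
stepsFrom-height≤ {j = j} i₀ j₀ (N ∷ w) (there m) =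
  subst (j ≤_) (sym (ℕ.+-suc j₀ (#N w))) (stepsFrom-height≤ i₀ (suc j₀) w m)
stepsFrom-height≤ i₀ j₀ (E ∷ w) (here refl) = ℕ.m≤m+n j₀ _
stepsFrom-height≤ i₀ j₀ (E ∷ w) (there m) = stepsFrom-height≤ (suc i₀) j₀ w m

north-height< : ∀ {i j} i₀ j₀ w → (N , i , j) ∈ stepsFrom i₀ j₀ w → j < j₀ + #N w
north-height< i₀ j₀ (N ∷ w) (here refl) = ℕ.m<m+n j₀ (s≤s z≤n)
north-height< {j = j} i₀ j₀ (N ∷ w) (there m) =
  subst (j <_) (sym (ℕ.+-suc j₀ (#N w))) (north-height< i₀ (suc j₀) w m)
north-height< i₀ j₀ (E ∷ w) (there m) = north-height< (suc i₀) j₀ w m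

north-at-height : ∀ {r} i₀ j₀ w → j₀ ≤ r → r < j₀ + #N w → ∃[ i ] (N , i , r) ∈ stepsFrom i₀ j₀ w
north-at-height i₀ j₀ [] j₀≤r r< = contradiction (subst (_ <_) (ℕ.+-identityʳ j₀) r<) (ℕ.≤⇒≯ j₀≤r)
north-at-height {r} i₀ j₀ (N ∷ w) j₀≤r r< with ℕ.m≤n⇒m<n∨m≡n j₀≤r
... | inj₂ refl = i₀ , here refl
... | inj₁ j₀<r =
  let i , m = north-at-height i₀ (suc j₀) w j₀<r (subst (r <_) (ℕ.+-suc j₀ (#N w)) r<) in i , there m
north-at-height i₀ j₀ (E ∷ w) j₀≤r r< =
  let i , m = north-at-height (suc i₀) j₀ w j₀≤r r< in i , there m

north-height-injective : ∀ {i i′ j} i₀ j₀ w → (N , i , j) ∈ stepsFrom i₀ j₀ w →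
                         (N , i′ , j) ∈ stepsFrom i₀ j₀ w → i ≡ i′
north-height-injective i₀ j₀ (N ∷ w) (here refl) (here refl) = refl
north-height-injective i₀ j₀ (N ∷ w) (here refl) (there m) =
  contradiction (proj₂ (stepsFrom-start≤ i₀ (suc j₀) w m)) (ℕ.n≮n j₀)
north-height-injective i₀ j₀ (N ∷ w) (there m) (here refl) =
  contradiction (proj₂ (stepsFrom-start≤ i₀ (suc j₀) w m)) (ℕ.n≮n j₀)
north-height-injective i₀ j₀ (N ∷ w) (there m) (there m′) = north-height-injective i₀ (suc j₀) w m m′
north-height-injective i₀ j₀ (E ∷ w) (there m) (there m′) = north-height-injective (suc i₀) j₀ w m m′

north-left-of-east : ∀ {i j r} i₀ j₀ w → (E , i , j) ∈ stepsFrom i₀ j₀ w → j₀ ≤ r → r < j →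
                     ∃[ i′ ] i′ ≤ i × (N , i′ , r) ∈ stepsFrom i₀ j₀ w
north-left-of-east i₀ j₀ (N ∷ w) (there m) j₀≤r r<j with ℕ.m≤n⇒m<n∨m≡n j₀≤r
... | inj₂ refl = i₀ , proj₁ (stepsFrom-start≤ i₀ (suc j₀) w m) , here refl
... | inj₁ j₀<r = let i′ , i′≤i , m′ = north-left-of-east i₀ (suc j₀) w m j₀<r r<j in i′ , i′≤i , there m′
north-left-of-east i₀ j₀ (E ∷ w) (here refl) j₀≤r r<j = contradiction r<j (ℕ.≤⇒≯ j₀≤r)
north-left-of-east i₀ j₀ (E ∷ w) (there m) j₀≤r r<j =
  let i′ , i′≤i , m′ = north-left-of-east (suc i₀) j₀ w m j₀≤r r<j in i′ , i′≤i , there m′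

east-at-column : ∀ {x} i₀ j₀ w → i₀ ≤ x → x < i₀ + #E w → ∃[ j ] j₀ ≤ j × (E , x , j) ∈ stepsFrom i₀ j₀ w
east-at-column i₀ j₀ [] i₀≤x x< = contradiction (subst (_ <_) (ℕ.+-identityʳ i₀) x<) (ℕ.≤⇒≯ i₀≤x)
east-at-column i₀ j₀ (N ∷ w) i₀≤x x< =
  let j , j₀<j , m = east-at-column i₀ (suc j₀) w i₀≤x x< in j , ℕ.<⇒≤ j₀<j , there m
east-at-column {x} i₀ j₀ (E ∷ w) i₀≤x x< with ℕ.m≤n⇒m<n∨m≡n i₀≤x
... | inj₂ refl = j₀ , ℕ.≤-refl , here refl
... | inj₁ i₀<x =
  let j , j₀≤j , m = east-at-column (suc i₀) j₀ w i₀<x (subst (x <_) (ℕ.+-suc i₀ (#E w)) x<) in j , j₀≤j , there m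

east-above-north : ∀ {i j x} i₀ j₀ w → (N , i , j) ∈ stepsFrom i₀ j₀ w → i ≤ x → x < i₀ + #E w →
                   ∃[ j′ ] j < j′ × (E , x , j′) ∈ stepsFrom i₀ j₀ w
east-above-north i₀ j₀ (N ∷ w) (here refl) i≤x x< =
  let j′ , j<j′ , m = east-at-column i₀ (suc j₀) w i≤x x< in j′ , j<j′ , there m
east-above-north i₀ j₀ (N ∷ w) (there mN) i≤x x< =
  let j′ , j<j′ , m = east-above-north i₀ (suc j₀) w mN i≤x x< in j′ , j<j′ , there m
east-above-north {x = x} i₀ j₀ (E ∷ w) (there mN) i≤x x< =
  let j′ , j<j′ , m = east-above-north (suc i₀) j₀ w mN i≤x (subst (x <_) (ℕ.+-suc i₀ (#E w)) x<) in j′ , j<j′ , there m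

-- North labels and the set H of a rational Dyck path

northLabels₀ : ℕ → ℕ → List Step → List ℤ
northLabels₀ n p w = concatMap (northLabel n p) (steps w)

∈-northLabels⁻ : ∀ {n p z} L → z ∈ concatMap (northLabel n p) L →
                 ∃[ i ] ∃[ j ] (N , i , j) ∈ L × z ≡ label n p i j
∈-northLabels⁻ {n} {p} L m with find (∈-concatMap⁻ (northLabel n p) m)
... | (N , i , j) , t∈L , here z≡ = i , j , t∈L , z≡

∈-northLabels⁺ : ∀ {n p i j} L → (N , i , j) ∈ L → label n p i j ∈ concatMap (northLabel n p) L
∈-northLabels⁺ {n} {p} L t∈L = ∈-concatMap⁺ (northLabel n p) (lose t∈L (here refl))

private
  positive? : ℤ → Bool
  positive? h = does (+ 0 ℤ.<? h)

∈-colLabels⁻ : ∀ {n p i j z} → z ∈ colLabels n p (E , i , j) →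
               ∃[ r ] r < j × z ≡ label n p (suc i) r × + 0 ℤ.< z
∈-colLabels⁻ {n} {p} {i} {j} m
  with z∈ , z>0 ← ∈-filter⁻ (T? ∘ positive?) {xs = map (label n p (suc i)) (upTo j)} m
  with r , r∈ , refl ← ∈-map⁻ (label n p (suc i)) z∈
  = r , ∈-upTo⁻ r∈ , refl , T-does⇒ (+ 0 ℤ.<? label n p (suc i) r) z>0

∈-colLabels⁺ : ∀ {n p i j r} → r < j → + 0 ℤ.< label n p (suc i) r → label n p (suc i) r ∈ colLabels n p (E , i , j)
∈-colLabels⁺ {n} {p} {i} {r = r} r<j h>0 =
  ∈-filter⁺ (T? ∘ positive?) (∈-map⁺ (label n p (suc i)) (∈-upTo⁺ r<j)) (⇒T-does (+ 0 ℤ.<? label n p (suc i) r) h>0)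

∈-concatColLabels⁻ : ∀ {n p z} L → z ∈ concatMap (colLabels n p) L →
                     ∃[ i ] ∃[ j ] ∃[ r ] (E , i , j) ∈ L × r < j × z ≡ label n p (suc i) r × + 0 ℤ.< z
∈-concatColLabels⁻ {n} {p} L m with find (∈-concatMap⁻ (colLabels n p) m)
... | (E , i , j) , t∈L , z∈ = let r , r<j , z≡ , z>0 = ∈-colLabels⁻ {n} {p} {i} z∈ in i , j , r , t∈L , r<j , z≡ , z>0

∈-concatColLabels⁺ : ∀ {n p i j r} L → (E , i , j) ∈ L → r < j → + 0 ℤ.< label n p (suc i) r →
                     label n p (suc i) r ∈ concatMap (colLabels n p) L
∈-concatColLabels⁺ {n} {p} {i} L t∈L r<j h>0 = ∈-concatMap⁺ (colLabels n p) (lose t∈L (∈-colLabels⁺ {n} {p} {i} r<j h>0))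

length-northLabels : ∀ n p i₀ j₀ w → length (concatMap (northLabel n p) (stepsFrom i₀ j₀ w)) ≡ #N w
length-northLabels n p i₀ j₀ []      = refl
length-northLabels n p i₀ j₀ (N ∷ w) = cong suc (length-northLabels n p i₀ (suc j₀) w)
length-northLabels n p i₀ j₀ (E ∷ w) = length-northLabels n p (suc i₀) j₀ w

IsGenerator : ℕ → List ℤ → ℤ → Set
IsGenerator n Hs z = + 0 ℤ.≤ z × z ∉ Hs × (z ℤ.< + n ⊎ z - + n ∈ Hs)

-- d n p w i j unfolds to length (filterᵇ (codinvCond n p (ℓ n p w i) (ℓ n p w j)) (H n p w)).
codinvCond : ℕ → ℕ → ℤ → ℤ → ℤ → Bool
codinvCond n p α β h = does (α ℤ.<? h) ∧ does (h ℤ.<? α ℤ.+ + p) ∧ does (n ℕ.∣? ℤ.∣ h - β ∣)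

codinvIndex? : (n p δ s : ℕ) → Dec (s * n < δ × δ < s * n + p)
codinvIndex? n p δ s = (s * n ℕ.<? δ) ×-dec (δ ℕ.<? s * n + p)

codinvIndices : ℕ → ℕ → ℕ → List ℕ
codinvIndices n p δ = filter (codinvIndex? n p δ) (map suc (upTo δ))

module DyckPath {n p : ℕ} {{_ : ℕ.NonZero n}} {{_ : ℕ.NonZero p}} (n⊥p : Coprime n p)
                {w : List Step} (w-dyck : IsRatDyck n p w) where

  NL : List ℤ
  NL = northLabels₀ n p w

  private
    #N≡n : #N w ≡ n
    #N≡n = proj₁ w-dyck

    #E≡p : #E w ≡ p
    #E≡p = proj₁ (proj₂ w-dyck)

    not-below : NotBelow n p w
    not-below = proj₂ (proj₂ w-dyck)

  north-height<n : ∀ {i j} → (N , i , j) ∈ steps w → j < n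
  north-height<n m = subst (_ <_) #N≡n (north-height< 0 0 w m)

  NL-nonneg : ∀ {ℓ} → ℓ ∈ NL → + 0 ℤ.≤ ℓ
  NL-nonneg ℓ∈ with i , j , m , refl ← ∈-northLabels⁻ (steps w) ℓ∈ = label-nonneg {n} {p} {i} {j} (All.lookup not-below m)

  NL-incongruent : ∀ {ℓ ℓ′} → ℓ ∈ NL → ℓ′ ∈ NL → + n ∣ ℓ - ℓ′ → ℓ ≡ ℓ′
  NL-incongruent ℓ∈ ℓ′∈ n∣
    with i , j , m , refl ← ∈-northLabels⁻ (steps w) ℓ∈
       | i′ , j′ , m′ , refl ← ∈-northLabels⁻ (steps w) ℓ′∈
    with refl ← label-congruent⇒height-≡ {i = i} {i′ = i′} n⊥p (north-height<n m) (north-height<n m′) n∣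
    with refl ← north-height-injective 0 0 w m m′
    = refl

  0∈NL : + 0 ∈ NL
  0∈NL with i , m ← north-at-height 0 0 w z≤n (subst (0 <_) (sym #N≡n) (ℕ.>-nonZero⁻¹ n))
       with refl ← ℕ.m*n≡0⇒m≡0 i n (ℕ.n≤0⇒n≡0 (All.lookup not-below m))
       = ∈-northLabels⁺ (steps w) m

  -- With u p ≡ 1 (mod n), the North step at height r ≡ z u (mod n) has label r p - i n ≡ z (mod n).
  NL-covers : ∀ z → ∃[ ℓ ] ℓ ∈ NL × + n ∣ ℓ - z
  NL-covers z with u , n∣up-1 ← p-invertible-mod-n n⊥p
    with i , m ← north-at-height 0 0 w z≤n (subst ((z ℤ.* u) %ℕ n <_) (sym #N≡n) (n%ℕd<d (z ℤ.* u) n))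
    = label n p i r , ∈-northLabels⁺ (steps w) m , subst (+ n ∣_) (sym ℓ-z≡) n∣ℓ-z
    where
    r = (z ℤ.* u) %ℕ n
    q = (z ℤ.* u) /ℕ n
    n∣r-zu : + n ∣ + r - z ℤ.* u
    n∣r-zu = divides (ℤ.- q) (begin
      + r - z ℤ.* u             ≡⟨ cong (_-_ (+ r)) (a≡a%ℕn+[a/ℕn]*n (z ℤ.* u) n) ⟩
      + r - (+ r ℤ.+ q ℤ.* + n) ≡⟨ lemma (+ r) q (+ n) ⟩
      ℤ.- q ℤ.* + n             ∎)
      where
      open ≡-Reasoning
      lemma : ∀ r q n → r - (r ℤ.+ q ℤ.* n) ≡ ℤ.- q ℤ.* n
      lemma = solve-∀
    ℓ-z≡ : label n p i r - z ≡ (+ r - z ℤ.* u) ℤ.* + p - + i ℤ.* + n ℤ.+ z ℤ.* (u ℤ.* + p - + 1)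
    ℓ-z≡ rewrite ℤ.pos-* r p | ℤ.pos-* i n = lemma (+ r) z u (+ p) (+ i) (+ n)
      where
      lemma : ∀ r z u p i n → r ℤ.* p - i ℤ.* n - z ≡ (r - z ℤ.* u) ℤ.* p - i ℤ.* n ℤ.+ z ℤ.* (u ℤ.* p - + 1)
      lemma = solve-∀
    n∣ℓ-z : + n ∣ (+ r - z ℤ.* u) ℤ.* + p - + i ℤ.* + n ℤ.+ z ℤ.* (u ℤ.* + p - + 1)
    n∣ℓ-z = ∣m∣n⇒∣m+n (∣m∣n⇒∣m-n (∣m⇒∣m*n (+ p) n∣r-zu) (∣n⇒∣m*n (+ i) ∣-refl)) (∣n⇒∣m*n z n∣up-1)

  ∈H⁻ : ∀ {h} → h ∈ H n p w → + 0 ℤ.< h × ∃[ ℓ ] ℓ ∈ NL × + n ∣ ℓ - h × h ℤ.< ℓ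
  ∈H⁻ h∈ with i , j , r , mE , r<j , refl , h>0 ← ∈-concatColLabels⁻ (steps w) h∈
         with i′ , i′≤i , mN ← north-left-of-east 0 0 w mE z≤n r<j
    = h>0 , label n p i′ r , ∈-northLabels⁺ (steps w) mN , n∣ , label-antitone-column r (s≤s i′≤i)
    where
    n∣ : + n ∣ label n p i′ r - label n p (suc i) r
    n∣ = divides (+ suc i - + i′) (trans (label-diff n p i′ r (suc i) r) (lemma (+ r) (+ p) (+ suc i - + i′) (+ n)))
      where
      lemma : ∀ a b c d → (a - a) ℤ.* b ℤ.+ c ℤ.* d ≡ c ℤ.* d
      lemma = solve-∀

  label-right-of-north∈H : ∀ {i j x} → (N , i , j) ∈ steps w → i ≤ x → + 0 ℤ.< label n p (suc x) j →
                           label n p (suc x) j ∈ H n p w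
  label-right-of-north∈H {i} {j} {x} mN i≤x h>0 =
    let j′ , j<j′ , mE = east-above-north 0 0 w mN i≤x (subst (x <_) (sym #E≡p) x<p)
    in ∈-concatColLabels⁺ (steps w) mE j<j′ h>0
    where
    x<p : x < p
    x<p = ℕ.<-trans (ℕ.n<1+n x) (ℕ.*-cancelʳ-< n (suc x) p (begin-strict
      suc x * n <⟨ ℤ.drop‿+<+ (0<-diff⇒< h>0) ⟩
      j * p     <⟨ ℕ.*-monoˡ-< p (north-height<n mN) ⟩
      n * p     ≡⟨ ℕ.*-comm n p ⟩
      p * n     ∎))
      where open ℕ.≤-Reasoning

  ∈H⁺ : ∀ {h ℓ} → + 0 ℤ.< h → ℓ ∈ NL → + n ∣ ℓ - h → h ℤ.< ℓ → h ∈ H n p w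
  ∈H⁺ {h} h>0 ℓ∈ n∣ h<ℓ
    with i , j , mN , refl ← ∈-northLabels⁻ (steps w) ℓ∈
    with t , ℓ-h≡ ← positive-multiple (<⇒0<-diff h<ℓ) n∣
    = subst (_∈ H n p w) (sym h≡) (label-right-of-north∈H mN (ℕ.m≤m+n i t) (subst (+ 0 ℤ.<_) h≡ h>0))
    where
    h≡ : h ≡ label n p (suc (i + t)) j
    h≡ = begin
      h                                   ≡⟨ lemma h (label n p i j) ⟩
      label n p i j - (label n p i j - h) ≡⟨ cong (_-_ (label n p i j)) ℓ-h≡ ⟩
      label n p i j - + (suc t * n)       ≡⟨ label-shift n p i j (suc t) ⟩
      label n p (i + suc t) j             ≡⟨ cong (λ k → label n p k j) (ℕ.+-suc i t) ⟩
      label n p (suc (i + t)) j           ∎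
      where
      open ≡-Reasoning
      lemma : ∀ a b → a ≡ b - (b - a)
      lemma = solve-∀

  private
    NL-unique-from : ∀ i₀ j₀ v → j₀ + #N v ≤ n → Unique (concatMap (northLabel n p) (stepsFrom i₀ j₀ v))
    NL-unique-from i₀ j₀ []      _   = []
    NL-unique-from i₀ j₀ (N ∷ v) j≤n = All.tabulate distinct ∷ NL-unique-from i₀ (suc j₀) v j≤n′
      where
      j≤n′ : suc j₀ + #N v ≤ n
      j≤n′ = subst (_≤ n) (ℕ.+-suc j₀ (#N v)) j≤n
      distinct : ∀ {z} → z ∈ concatMap (northLabel n p) (stepsFrom i₀ (suc j₀) v) → label n p i₀ j₀ ≢ z
      distinct z∈ eq
        with i , j , m , refl ← ∈-northLabels⁻ (stepsFrom i₀ (suc j₀) v) z∈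
        with _ , refl ← label-injective {i = i₀} {i′ = i} n⊥p (ℕ.<-≤-trans (ℕ.m≤m+n (suc j₀) (#N v)) j≤n′)
                                           (ℕ.<-≤-trans (north-height< i₀ (suc j₀) v m) j≤n′) eq
        = ℕ.n≮n j₀ (proj₂ (stepsFrom-start≤ i₀ (suc j₀) v m))
    NL-unique-from i₀ j₀ (E ∷ v) j≤n = NL-unique-from (suc i₀) j₀ v j≤n

    H-unique-from : ∀ i₀ j₀ v → j₀ + #N v ≤ n → Unique (concatMap (colLabels n p) (stepsFrom i₀ j₀ v))
    H-unique-from i₀ j₀ []      _   = []
    H-unique-from i₀ j₀ (N ∷ v) j≤n = H-unique-from i₀ (suc j₀) v (subst (_≤ n) (ℕ.+-suc j₀ (#N v)) j≤n)
    H-unique-from i₀ j₀ (E ∷ v) j≤n = Unique.++⁺ column-unique (H-unique-from (suc i₀) j₀ v j≤n) disjoint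
      where
      column-unique : Unique (colLabels n p (E , i₀ , j₀))
      column-unique = Unique.filter⁺ (T? ∘ positive?) (Unique.map⁺ (label-injectiveʳ {n} {p} {suc i₀}) (Unique.upTo⁺ j₀))
      disjoint : ∀ {z} → z ∈ colLabels n p (E , i₀ , j₀) × z ∈ concatMap (colLabels n p) (stepsFrom (suc i₀) j₀ v) → ⊥
      disjoint (z∈ , z∈′)
        with r , r<j₀ , refl , _ ← ∈-colLabels⁻ {n} {p} {i₀} z∈
        with i , j , r′ , mE , r′<j , eq , _ ← ∈-concatColLabels⁻ (stepsFrom (suc i₀) j₀ v) z∈′
        with refl , _ ← label-injective {i = suc i₀} {i′ = suc i} n⊥p (ℕ.<-≤-trans r<j₀ (ℕ.≤-trans (ℕ.m≤m+n j₀ (#N v)) j≤n))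
                          (ℕ.<-≤-trans r′<j (ℕ.≤-trans (stepsFrom-height≤ (suc i₀) j₀ v mE) j≤n)) eq
        = ℕ.n≮n _ (proj₁ (stepsFrom-start≤ (suc i₀) j₀ v mE))

  NL-unique : Unique NL
  NL-unique = NL-unique-from 0 0 w (ℕ.≤-reflexive #N≡n)

  H-unique : Unique (H n p w)
  H-unique = H-unique-from 0 0 w (ℕ.≤-reflexive #N≡n)

  NL-length : length NL ≡ n
  NL-length = trans (length-northLabels n p 0 0 w) #N≡n

  NL⇒generator : ∀ {z} → z ∈ NL → IsGenerator n (H n p w) z
  NL⇒generator {z} z∈ = NL-nonneg z∈ , z∉H , predecessor
    where
    z∉H : z ∉ H n p w
    z∉H z∈H with _ , ℓ , ℓ∈ , n∣ℓ-z , z<ℓ ← ∈H⁻ z∈H = ℤ.<⇒≢ z<ℓ (sym (NL-incongruent ℓ∈ z∈ n∣ℓ-z))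
    n∣z-[z-n] : + n ∣ z - (z - + n)
    n∣z-[z-n] = divides (+ 1) (lemma z (+ n))
      where
      lemma : ∀ z n → z - (z - n) ≡ + 1 ℤ.* n
      lemma = solve-∀
    predecessor : z ℤ.< + n ⊎ z - + n ∈ H n p w
    predecessor with z ℤ.<? + n | + 0 ℤ.<? z - + n
    ... | yes z<n | _       = inj₁ z<n
    ... | no  z≮n | yes z>n = inj₂ (∈H⁺ z>n z∈ n∣z-[z-n] (<-from-diff (ℤ.+<+ (ℕ.>-nonZero⁻¹ n)) (lemma z (+ n))))
      where
      lemma : ∀ z n → z - (z - n) ≡ n - + 0
      lemma = solve-∀
    ... | no  z≮n | no  z≯n = contradiction n≡0 (ℕ.≢-nonZero⁻¹ n)
      where
      z≡n : z ≡ + n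
      z≡n = ℤ.≤-antisym (≤-from-diff (ℤ.≮⇒≥ z≯n) (lemma z (+ n))) (ℤ.≮⇒≥ z≮n)
        where
        lemma : ∀ z n → n - z ≡ + 0 - (z - n)
        lemma = solve-∀
      n≡0 : n ≡ 0
      n≡0 = ℤ.+-injective (NL-incongruent (subst (_∈ NL) z≡n z∈) 0∈NL (divides (+ 1) (lemma (+ n))))
        where
        lemma : ∀ n → n - + 0 ≡ + 1 ℤ.* n
        lemma = solve-∀

  private
    no-NL-above-outside : ∀ {ℓ z} → ℓ ∈ NL → + n ∣ ℓ - z → + 0 ℤ.≤ z → z ∉ H n p w → ¬ z ℤ.< ℓ
    no-NL-above-outside {ℓ} {z} ℓ∈ n∣ℓ-z z≥0 z∉H z<ℓ with + 0 ℤ.<? z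
    ... | yes z>0 = z∉H (∈H⁺ z>0 ℓ∈ n∣ℓ-z z<ℓ)
    ... | no  z≯0 = ℤ.<⇒≢ (subst (ℤ._< ℓ) z≡0 z<ℓ)
                      (sym (NL-incongruent ℓ∈ 0∈NL (subst (λ v → + n ∣ ℓ - v) z≡0 n∣ℓ-z)))
      where
      z≡0 : z ≡ + 0
      z≡0 = ℤ.≤-antisym (ℤ.≮⇒≥ z≯0) z≥0

    no-NL-below-generator : ∀ {ℓ z} → ℓ ∈ NL → + n ∣ ℓ - z → z ℤ.< + n ⊎ z - + n ∈ H n p w → ¬ ℓ ℤ.< z
    no-NL-below-generator {ℓ} {z} ℓ∈ n∣ℓ-z predecessor ℓ<z =
      ℤ.<⇒≱ (z-ℓ<n predecessor) (multiple-≥ (<⇒0<-diff ℓ<z) n∣z-ℓ)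
      where
      n∣z-ℓ : + n ∣ z - ℓ
      n∣z-ℓ = subst (+ n ∣_) (lemma ℓ z) (∣m⇒∣-m n∣ℓ-z)
        where
        lemma : ∀ ℓ z → ℤ.- (ℓ - z) ≡ z - ℓ
        lemma = solve-∀
      z-ℓ<n : z ℤ.< + n ⊎ z - + n ∈ H n p w → z - ℓ ℤ.< + n
      z-ℓ<n (inj₁ z<n)   = ℤ.≤-<-trans (ℤ.i-j≤i z ℓ {{ℤ.nonNegative (NL-nonneg ℓ∈)}}) z<n
      z-ℓ<n (inj₂ z-n∈H) = below (∈H⁻ z-n∈H)
        where
        below : + 0 ℤ.< z - + n × ∃[ ℓ′ ] ℓ′ ∈ NL × + n ∣ ℓ′ - (z - + n) × z - + n ℤ.< ℓ′ → z - ℓ ℤ.< + n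
        below (_ , ℓ′ , ℓ′∈ , n∣ℓ′-[z-n] , z-n<ℓ′) =
          <-from-diff (subst (z - + n ℤ.<_) ℓ′≡ℓ z-n<ℓ′) (lemma′ ℓ z (+ n))
          where
          lemma : ∀ ℓ′ z ℓ n → (ℓ′ - (z - n)) - (ℓ - z) - n ≡ ℓ′ - ℓ
          lemma = solve-∀
          lemma′ : ∀ ℓ z n → n - (z - ℓ) ≡ ℓ - (z - n)
          lemma′ = solve-∀
          ℓ′≡ℓ : ℓ′ ≡ ℓ
          ℓ′≡ℓ = NL-incongruent ℓ′∈ ℓ∈
                   (subst (+ n ∣_) (lemma ℓ′ z ℓ (+ n)) (∣m∣n⇒∣m-n (∣m∣n⇒∣m-n n∣ℓ′-[z-n] n∣ℓ-z) ∣-refl))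

  generator⇒NL : ∀ {z} → IsGenerator n (H n p w) z → z ∈ NL
  generator⇒NL {z} (z≥0 , z∉H , predecessor) = from-cover (NL-covers z)
    where
    from-cover : ∃[ ℓ ] ℓ ∈ NL × + n ∣ ℓ - z → z ∈ NL
    from-cover (ℓ , ℓ∈ , n∣ℓ-z) with ℤ.<-cmp ℓ z
    ... | tri≈ _ ℓ≡z _ = subst (_∈ NL) ℓ≡z ℓ∈
    ... | tri> _ _ z<ℓ = contradiction z<ℓ (no-NL-above-outside ℓ∈ n∣ℓ-z z≥0 z∉H)
    ... | tri< ℓ<z _ _ = contradiction ℓ<z (no-NL-below-generator ℓ∈ n∣ℓ-z predecessor)

  private
    codinv⇒index : ∀ {α β δ h} → β ∈ NL → β - α ≡ + δ → h ∈ H n p w →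
                   α ℤ.< h → h ℤ.< α ℤ.+ + p → + n ∣ h - β →
                   ∃[ s ] s ∈ codinvIndices n p δ × h ≡ β - + (s * n)
    codinv⇒index {α} {β} {δ} {h} β∈ β-α≡δ h∈ α<h h<α+p n∣h-β = below (∈H⁻ h∈)
      where
      lemma₁ : ∀ ℓ h β → (ℓ - h) ℤ.+ (h - β) ≡ ℓ - β
      lemma₁ = solve-∀
      below : + 0 ℤ.< h × ∃[ ℓ ] ℓ ∈ NL × + n ∣ ℓ - h × h ℤ.< ℓ → ∃[ s ] s ∈ codinvIndices n p δ × h ≡ β - + (s * n)
      below (_ , ℓ , ℓ∈ , n∣ℓ-h , h<ℓ)
        with refl ← NL-incongruent ℓ∈ β∈ (subst (+ n ∣_) (lemma₁ ℓ h β) (∣m∣n⇒∣m+n n∣ℓ-h n∣h-β))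
        with t , β-h≡ ← positive-multiple (<⇒0<-diff h<ℓ) n∣ℓ-h
        = suc t , ∈-filter⁺ (codinvIndex? n p δ) (∈-map⁺ suc (∈-upTo⁺ t<δ)) (sn<δ , δ<sn+p) ,
          trans (lemma₂ h ℓ) (cong (_-_ ℓ) β-h≡)
        where
        lemma₂ : ∀ h β → h ≡ β - (β - h)
        lemma₂ = solve-∀
        lemma₃ : ∀ α β h → (β - α) - (β - h) ≡ h - α
        lemma₃ = solve-∀
        lemma₄ : ∀ α β h p → ((β - h) ℤ.+ p) - (β - α) ≡ (α ℤ.+ p) - h
        lemma₄ = solve-∀
        sn<δ : suc t * n < δ
        sn<δ = ℤ.drop‿+<+ (<-from-diff α<h (subst₂ (λ a b → a - b ≡ h - α) β-α≡δ β-h≡ (lemma₃ α ℓ h)))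
        δ<sn+p : δ < suc t * n + p
        δ<sn+p = ℤ.drop‿+<+ (<-from-diff h<α+p
                   (subst₂ (λ a b → a - b ≡ α ℤ.+ + p - h)
                     (trans (cong (ℤ._+ + p) β-h≡) (sym (ℤ.pos-+ (suc t * n) p))) β-α≡δ (lemma₄ α ℓ h (+ p))))
        t<δ : t < δ
        t<δ = ℕ.<-≤-trans (ℕ.n<1+n t) (ℕ.≤-trans (ℕ.m≤m*n (suc t) n) (ℕ.<⇒≤ sn<δ))

    index⇒codinv : ∀ {α β δ s} → α ∈ NL → β ∈ NL → β - α ≡ + δ → s ∈ codinvIndices n p δ →
                   β - + (s * n) ∈ H n p w × α ℤ.< β - + (s * n) × β - + (s * n) ℤ.< α ℤ.+ + p ×
                   + n ∣ (β - + (s * n)) - β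
    index⇒codinv {α} {β} {δ} {s} α∈ β∈ β-α≡δ s∈
      with s∈′ , sn<δ , δ<sn+p ← ∈-filter⁻ (codinvIndex? n p δ) {xs = map suc (upTo δ)} s∈
      with t , _ , refl ← ∈-map⁻ suc s∈′
      = ∈H⁺ (ℤ.≤-<-trans (NL-nonneg α∈) α<h) β∈ (divides (+ s) (trans (lemma₃ β sn) (ℤ.pos-* s n))) h<β , α<h , h<α+p ,
        divides (ℤ.- + s) (trans (lemma₄ β sn) (trans (cong ℤ.-_ (ℤ.pos-* s n)) (ℤ.neg-distribˡ-* (+ s) (+ n))))
      where
      sn = + (s * n)
      h = β - sn
      lemma₁ : ∀ α β sn → (β - sn) - α ≡ (β - α) - sn
      lemma₁ = solve-∀
      lemma₂ : ∀ α β sn p → (α ℤ.+ p) - (β - sn) ≡ (sn ℤ.+ p) - (β - α)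
      lemma₂ = solve-∀
      lemma₃ : ∀ β x → β - (β - x) ≡ x
      lemma₃ = solve-∀
      lemma₄ : ∀ β x → (β - x) - β ≡ ℤ.- x
      lemma₄ = solve-∀
      α<h : α ℤ.< h
      α<h = <-from-diff (ℤ.+<+ sn<δ) (trans (lemma₁ α β sn) (cong (_- sn) β-α≡δ))
      h<α+p : h ℤ.< α ℤ.+ + p
      h<α+p = <-from-diff (ℤ.+<+ δ<sn+p)
                (trans (lemma₂ α β sn (+ p)) (cong₂ _-_ (sym (ℤ.pos-+ (s * n) p)) β-α≡δ))
      h<β : h ℤ.< β
      h<β = <-from-diff (ℤ.+<+ (ℕ.>-nonZero⁻¹ (s * n) {{ℕ.m*n≢0 s n}})) (trans (lemma₃ β sn) (sym (ℤ.+-identityʳ sn)))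

  codinv-count : ∀ {α β δ} → α ∈ NL → β ∈ NL → β - α ≡ + δ →
                 length (filterᵇ (codinvCond n p α β) (H n p w)) ≡ length (codinvIndices n p δ)
  codinv-count {α} {β} {δ} α∈ β∈ β-α≡δ = begin
    length (filterᵇ (codinvCond n p α β) (H n p w)) ≡⟨ ↭-length (unique-set⇒↭ codinv-unique shifted-unique (mk⇔ to from)) ⟩
    length (map shift (codinvIndices n p δ))        ≡⟨ List.length-map shift (codinvIndices n p δ) ⟩
    length (codinvIndices n p δ)                    ∎
    where
    open ≡-Reasoning
    shift : ℕ → ℤ
    shift s = β - + (s * n)
    codinv-unique : Unique (filterᵇ (codinvCond n p α β) (H n p w))
    codinv-unique = Unique.filter⁺ (T? ∘ codinvCond n p α β) H-unique
    shifted-unique : Unique (map shift (codinvIndices n p δ))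
    shifted-unique = Unique.map⁺ shift-injective
      (Unique.filter⁺ (codinvIndex? n p δ) (Unique.map⁺ ℕ.suc-injective (Unique.upTo⁺ δ)))
      where
      shift-injective : ∀ {s s′} → shift s ≡ shift s′ → s ≡ s′
      shift-injective {s} {s′} eq = ℕ.*-cancelʳ-≡ s s′ n (ℤ.+-injective (ℤ.neg-injective (+-cancelˡ β _ _ eq)))
    to : ∀ {h} → h ∈ filterᵇ (codinvCond n p α β) (H n p w) → h ∈ map shift (codinvIndices n p δ)
    to {h} h∈ with h∈H , cond ← ∈-filter⁻ (T? ∘ codinvCond n p α β) {xs = H n p w} h∈
      with α<h? , rest ← Equivalence.to T-∧ cond
      with h<α+p? , n∣? ← Equivalence.to T-∧ rest
      with s , s∈ , refl ← codinv⇒index β∈ β-α≡δ h∈H (T-does⇒ (α ℤ.<? h) α<h?) (T-does⇒ (h ℤ.<? α ℤ.+ + p) h<α+p?)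
                             (∣ᵤ⇒∣ (T-does⇒ (n ℕ.∣? ℤ.∣ h - β ∣) n∣?))
      = ∈-map⁺ shift s∈
    from : ∀ {h} → h ∈ map shift (codinvIndices n p δ) → h ∈ filterᵇ (codinvCond n p α β) (H n p w)
    from h∈ with s , s∈ , refl ← ∈-map⁻ shift h∈
      with h∈H , α<h , h<α+p , n∣h-β ← index⇒codinv α∈ β∈ β-α≡δ s∈
      = ∈-filter⁺ (T? ∘ codinvCond n p α β) h∈H
          (Equivalence.from T-∧ (⇒T-does (α ℤ.<? shift s) α<h ,
             Equivalence.from T-∧ (⇒T-does (shift s ℤ.<? α ℤ.+ + p) h<α+p ,
                                   ⇒T-does (n ℕ.∣? ℤ.∣ shift s - β ∣) (∣⇒∣ᵤ n∣h-β))))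

  northLabels-length : length (northLabels n p w) ≡ n
  northLabels-length = trans (↭-length (sort-↭ NL)) NL-length

  ℓ-∈ : ∀ {k} → 1 ≤ k → k ≤ n → ℓ n p w k ∈ NL
  ℓ-∈ {suc k} _ k<n = ∈-resp-↭ (sort-↭ NL) (atℤ-∈ (sort NL) (subst (k <_) (sym northLabels-length) k<n))

  ℓ-mono : ∀ {i j} → 1 ≤ i → i ≤ j → j ≤ n → ℓ n p w i ℤ.≤ ℓ n p w j
  ℓ-mono {suc i} {suc j} _ (s≤s i≤j) j<n =
    atℤ-mono (Sorted⇒AllPairs ℤ.≤-totalOrder (sort-↗ NL)) i≤j (subst (j <_) (sym northLabels-length) j<n)

-- Conjugate partitions and first-column hooks

Decreasing : List ℕ → Set
Decreasing = Linked (λ a b → b ≤ a)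

#parts> : ℕ → List ℕ → ℕ
#parts> c μ = length (filterᵇ (λ a → does (suc c ℕ.≤? a)) μ)

private
  exceeds? : ℕ → ℕ → Bool
  exceeds? c a = does (suc c ℕ.≤? a)

#parts>-accept : ∀ {c x} xs → c < x → #parts> c (x ∷ xs) ≡ suc (#parts> c xs)
#parts>-accept {c} {x} xs c<x = cong length (List.filter-accept (T? ∘ exceeds? c) {x} {xs} (⇒T-does (suc c ℕ.≤? x) c<x))

#parts>-none : ∀ {c} xs → All (_≤ c) xs → #parts> c xs ≡ 0
#parts>-none {c} xs xs≤c =
  cong length (List.filter-none (T? ∘ exceeds? c) (All.map (λ {x} x≤c → ℕ.≤⇒≯ x≤c ∘ T-does⇒ (suc c ℕ.≤? x)) xs≤c))

#parts>≤length : ∀ c μ → #parts> c μ ≤ length μ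
#parts>≤length c μ = List.length-filter (T? ∘ exceeds? c) μ

decreasing-head-max : ∀ {x xs} → Decreasing (x ∷ xs) → All (_≤ x) xs
decreasing-head-max μ-dec with x≥xs ∷ _ ← Linked⇒AllPairs (λ b≤a c≤b → ℕ.≤-trans c≤b b≤a) μ-dec = x≥xs

at-∈ : ∀ μ {r} → r < length μ → at μ r ∈ μ
at-∈ (x ∷ μ) {zero}  _         = here refl
at-∈ (x ∷ μ) {suc r} (s≤s r<) = there (at-∈ μ r<)

at-antitone : ∀ {μ r r′} → Decreasing μ → r ≤ r′ → r′ < length μ → at μ r′ ≤ at μ r
at-antitone {x ∷ μ} {zero}  {zero}   _     _         _        = ℕ.≤-refl
at-antitone {x ∷ μ} {zero}  {suc r′} μ-dec _         (s≤s r′<) = All.lookup (decreasing-head-max μ-dec) (at-∈ μ r′<)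
at-antitone {x ∷ μ} {suc r} {suc r′} μ-dec (s≤s r≤r′) (s≤s r′<) = at-antitone (Linked.tail μ-dec) r≤r′ r′<

at-positive : ∀ {μ r} → All (0 <_) μ → r < length μ → 0 < at μ r
at-positive {x ∷ μ} {zero}  (x>0 All.∷ _)  _        = x>0
at-positive {x ∷ μ} {suc r} (_ All.∷ μ>0) (s≤s r<) = at-positive μ>0 r<

#parts>-lower : ∀ {μ r c} → Decreasing μ → r < length μ → c < at μ r → r < #parts> c μ
#parts>-lower {x ∷ μ} {r} {c} μ-dec r< c<μᵣ =
  subst (r <_) (sym (#parts>-accept μ (ℕ.<-≤-trans c<μᵣ (at-antitone μ-dec z≤n r<)))) (lower r r< c<μᵣ)
  where
  lower : ∀ r → r < suc (length μ) → c < at (x ∷ μ) r → r < suc (#parts> c μ)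
  lower zero    _         _     = s≤s z≤n
  lower (suc r) (s≤s r<) c<μᵣ = s≤s (#parts>-lower (Linked.tail μ-dec) r< c<μᵣ)

#parts>-upper : ∀ {μ r c} → Decreasing μ → r < length μ → at μ r ≤ c → #parts> c μ ≤ r
#parts>-upper {x ∷ μ} {zero}  {c} μ-dec _ x≤c =
  ℕ.≤-reflexive (#parts>-none (x ∷ μ) (x≤c All.∷ All.map (λ y≤x → ℕ.≤-trans y≤x x≤c) (decreasing-head-max μ-dec)))
#parts>-upper {x ∷ μ} {suc r} {c} μ-dec (s≤s r<) μᵣ≤c with c ℕ.<? x
... | yes c<x = subst (_≤ suc r) (sym (#parts>-accept μ c<x)) (s≤s (#parts>-upper (Linked.tail μ-dec) r< μᵣ≤c))
... | no  c≮x = ℕ.≤-trans (#parts>-upper {x ∷ μ} {zero} {c} μ-dec (s≤s z≤n) (ℕ.≮⇒≥ c≮x)) z≤n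

private
  at-map-applyUpTo : ∀ (f g : ℕ → ℕ) {M c} → c < M → at (map f (applyUpTo g M)) c ≡ f (g c)
  at-map-applyUpTo f g {suc M} {zero}  _         = refl
  at-map-applyUpTo f g {suc M} {suc c} (s≤s c<) = at-map-applyUpTo f (g ∘ suc) c<

  foldr-⊔-≤ : ∀ {m} xs → All (_≤ m) xs → foldr _⊔_ 0 xs ≤ m
  foldr-⊔-≤ []       All.[]           = z≤n
  foldr-⊔-≤ (x ∷ xs) (x≤m All.∷ xs≤m) = ℕ.⊔-lub x≤m (foldr-⊔-≤ xs xs≤m)

decreasing-max : ∀ {m μ} → Decreasing (m ∷ μ) → foldr _⊔_ 0 (m ∷ μ) ≡ m
decreasing-max {m} {μ} μ-dec = ℕ.m≥n⇒m⊔n≡m (foldr-⊔-≤ μ (decreasing-head-max μ-dec))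

conj-length : ∀ {m μ} → Decreasing (m ∷ μ) → length (conj (m ∷ μ)) ≡ m
conj-length {m} {μ} μ-dec = begin
  length (conj (m ∷ μ))         ≡⟨ List.length-map _ (upTo (foldr _⊔_ 0 (m ∷ μ))) ⟩
  length (upTo (foldr _⊔_ 0 (m ∷ μ))) ≡⟨ List.length-upTo _ ⟩
  foldr _⊔_ 0 (m ∷ μ)           ≡⟨ decreasing-max μ-dec ⟩
  m                             ∎
  where open ≡-Reasoning

conj-at : ∀ {m μ c} → Decreasing (m ∷ μ) → c < m → at (conj (m ∷ μ)) c ≡ #parts> c (m ∷ μ)
conj-at {m} {μ} {c} μ-dec c<m =
  at-map-applyUpTo (λ c → #parts> c (m ∷ μ)) (λ c → c) (subst (c <_) (sym (decreasing-max μ-dec)) c<m)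

conj-at-0 : ∀ {μ} → IsPartition μ → 0 < length μ → at (conj μ) 0 ≡ length μ
conj-at-0 {m ∷ μ} (μ>0@(m>0 All.∷ _) , μ-dec) _ = trans (conj-at μ-dec m>0)
  (cong length (List.filter-all (T? ∘ exceeds? 0) (All.map (λ {x} x>0 → ⇒T-does (1 ℕ.≤? x) x>0) μ>0)))

IsFirstColumnHook : List ℕ → ℕ → Set
IsFirstColumnHook μ g = ∃[ r ] r < length μ × g + suc r ≡ at μ r + length μ

private
  hook-0-formula : ∀ {μ r} → IsPartition μ → r < length μ → hook μ r 0 + suc r ≡ at μ r + length μ
  hook-0-formula {μ} {r} μ-part@(μ>0 , _) r< = begin
    hook μ r 0 + suc r                                          ≡⟨ lemma (at μ r ∸ 1) (at (conj μ) 0 ∸ suc r) (suc r) ⟩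
    (at μ r ∸ 1 + 1) + (at (conj μ) 0 ∸ suc r + suc r)          ≡⟨ cong₂ _+_ (ℕ.m∸n+n≡m μᵣ≥1) (ℕ.m∸n+n≡m r<μ′₀) ⟩
    at μ r + at (conj μ) 0                                      ≡⟨ cong (_+_ (at μ r)) μ′₀≡k ⟩
    at μ r + length μ                                           ∎
    where
    open ≡-Reasoning
    lemma : ∀ a b c → (a + b + 1) + c ≡ (a + 1) + (b + c)
    lemma = ℕ-solve-∀
    μᵣ≥1 : 1 ≤ at μ r
    μᵣ≥1 = at-positive μ>0 r<
    μ′₀≡k : at (conj μ) 0 ≡ length μ
    μ′₀≡k = conj-at-0 μ-part (ℕ.<-≤-trans (s≤s z≤n) r<)
    r<μ′₀ : suc r ≤ at (conj μ) 0
    r<μ′₀ = subst (suc r ≤_) (sym μ′₀≡k) r<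

∈-firstColHooks⁻ : ∀ {μ h} → IsPartition μ → h ∈ map +_ (firstColHooks μ) → ∃[ g ] h ≡ + g × IsFirstColumnHook μ g
∈-firstColHooks⁻ {μ} μ-part h∈
  with g , g∈ , refl ← ∈-map⁻ +_ h∈
  with r , r∈ , refl ← ∈-map⁻ (λ r → hook μ r 0) g∈
  = hook μ r 0 , refl , r , ∈-upTo⁻ r∈ , hook-0-formula μ-part (∈-upTo⁻ r∈)

∈-firstColHooks⁺ : ∀ {μ g} → IsPartition μ → IsFirstColumnHook μ g → + g ∈ map +_ (firstColHooks μ)
∈-firstColHooks⁺ {μ} {g} μ-part (r , r< , eq) =
  subst (λ v → + v ∈ map +_ (firstColHooks μ)) hook≡g (∈-map⁺ +_ (∈-map⁺ (λ r → hook μ r 0) (∈-upTo⁺ r<)))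
  where
  hook≡g : hook μ r 0 ≡ g
  hook≡g = ℕ.+-cancelʳ-≡ (suc r) _ _ (trans (hook-0-formula μ-part r<) (sym eq))

module FirstColumnHooks {m : ℕ} {μ′ : List ℕ} (μ-part : IsPartition (m ∷ μ′)) where

  private
    μ = m ∷ μ′
    k = length μ
    μ-dec : Decreasing μ
    μ-dec = proj₂ μ-part

  M : ℕ
  M = m + length μ′

  private
    M+1≡m+k : M + 1 ≡ m + k
    M+1≡m+k = trans (ℕ.+-assoc m (length μ′) 1) (cong (_+_ m) (ℕ.+-comm (length μ′) 1))

    μᵣ≤m : ∀ {r} → r < k → at μ r ≤ m
    μᵣ≤m r<k = at-antitone μ-dec z≤n r<k

  -- M - g is the first-column hook of the conjugate partition in column c.
  IsCohook : ℕ → Set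
  IsCohook g = ∃[ c ] c < m × g + #parts> c μ ≡ c + k

  hook-cohook-disjoint : ∀ {g} → IsFirstColumnHook μ g → IsCohook g → ⊥
  hook-cohook-disjoint {g} (r , r<k , hook-eq) (c , c<m , cohook-eq) with c ℕ.<? at μ r
  ... | yes c<μᵣ = ℕ.<-irrefl refl (begin-strict
    at μ r + k    ≡⟨ hook-eq ⟨
    g + suc r     ≤⟨ ℕ.+-monoʳ-≤ g (#parts>-lower μ-dec r<k c<μᵣ) ⟩
    g + #parts> c μ ≡⟨ cohook-eq ⟩
    c + k         <⟨ ℕ.+-monoˡ-< k c<μᵣ ⟩
    at μ r + k    ∎)
    where open ℕ.≤-Reasoning
  ... | no  c≮μᵣ = ℕ.<-irrefl refl (begin-strict
    c + k           ≡⟨ cohook-eq ⟨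
    g + #parts> c μ ≤⟨ ℕ.+-monoʳ-≤ g (#parts>-upper μ-dec r<k (ℕ.≮⇒≥ c≮μᵣ)) ⟩
    g + r           <⟨ ℕ.+-monoʳ-< g (ℕ.n<1+n r) ⟩
    g + suc r       ≡⟨ hook-eq ⟩
    at μ r + k      ≤⟨ ℕ.+-monoˡ-≤ k (ℕ.≮⇒≥ c≮μᵣ) ⟩
    c + k           ∎)
    where open ℕ.≤-Reasoning

  private
    next-row<k : ∀ {r s} → suc r + suc s ≡ k → suc r < k
    next-row<k {r} eq = subst (suc r <_) eq (s≤s (ℕ.m<m+n r (s≤s z≤n)))

    -- Scan the rows downwards while g lies strictly below the hook of row r; the first row
    -- whose hook drops below g determines the column of the cohook.
    cohook-search : ∀ {g} → ¬ IsFirstColumnHook μ g → ∀ s r → suc r + s ≡ k → g + suc r < at μ r + k → IsCohook g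
    cohook-search {g} ¬hook zero r r+1+0≡k below = g , g<m , cong (_+_ g) #parts>≡k
      where
      r+1≡k : suc r ≡ k
      r+1≡k = trans (sym (ℕ.+-identityʳ (suc r))) r+1+0≡k
      r<k : r < k
      r<k = subst (r <_) r+1≡k (ℕ.n<1+n r)
      g<μᵣ : g < at μ r
      g<μᵣ = ℕ.+-cancelʳ-< k g (at μ r) (subst (λ x → g + x < at μ r + k) r+1≡k below)
      g<m : g < m
      g<m = ℕ.<-≤-trans g<μᵣ (μᵣ≤m r<k)
      #parts>≡k : #parts> g μ ≡ k
      #parts>≡k = ℕ.≤-antisym (#parts>≤length g μ) (subst (_≤ #parts> g μ) r+1≡k (#parts>-lower μ-dec r<k g<μᵣ))
    cohook-search {g} ¬hook (suc s) r r+1+s≡k below with at μ (suc r) + k ℕ.≤? g + suc r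
    ... | yes hook≤g = c , c<m , trans (cong (_+_ g) #parts>≡r+1) (sym c+k≡g+r+1)
      where
      r+1<k : suc r < k
      r+1<k = next-row<k r+1+s≡k
      c = g + suc r ∸ k
      c+k≡g+r+1 : c + k ≡ g + suc r
      c+k≡g+r+1 = ℕ.m∸n+n≡m (ℕ.≤-trans (ℕ.m≤n+m k (at μ (suc r))) hook≤g)
      c<μᵣ : c < at μ r
      c<μᵣ = ℕ.+-cancelʳ-< k c (at μ r) (subst (_< at μ r + k) (sym c+k≡g+r+1) below)
      c<m : c < m
      c<m = ℕ.<-≤-trans c<μᵣ (μᵣ≤m (ℕ.<-trans (ℕ.n<1+n r) r+1<k))
      μᵣ₊₁≤c : at μ (suc r) ≤ c
      μᵣ₊₁≤c = ℕ.+-cancelʳ-≤ k (at μ (suc r)) c (subst (at μ (suc r) + k ≤_) (sym c+k≡g+r+1) hook≤g)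
      #parts>≡r+1 : #parts> c μ ≡ suc r
      #parts>≡r+1 = ℕ.≤-antisym (#parts>-upper μ-dec r+1<k μᵣ₊₁≤c)
                                (#parts>-lower μ-dec (ℕ.<-trans (ℕ.n<1+n r) r+1<k) c<μᵣ)
    ... | no  hook≰g = cohook-search ¬hook s (suc r) (trans (sym (ℕ.+-suc (suc r) s)) r+1+s≡k) below′
      where
      r+1<k : suc r < k
      r+1<k = next-row<k r+1+s≡k
      below′ : g + suc (suc r) < at μ (suc r) + k
      below′ = ℕ.≤∧≢⇒< (subst (_≤ at μ (suc r) + k) (sym (ℕ.+-suc g (suc r))) (ℕ.≰⇒> hook≰g))
                        (λ eq → ¬hook (suc r , r+1<k , eq))

  hook-cohook-cover : ∀ {g} → g ≤ M → ¬ IsFirstColumnHook μ g → IsCohook g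
  hook-cohook-cover {g} g≤M ¬hook = cohook-search ¬hook (length μ′) 0 refl g+1<m+k
    where
    g+1<m+k : g + 1 < m + k
    g+1<m+k = subst (g + 1 <_) M+1≡m+k
      (ℕ.+-monoˡ-< 1 (ℕ.≤∧≢⇒< g≤M (λ g≡M → ¬hook (0 , s≤s z≤n , trans (cong (_+ 1) g≡M) M+1≡m+k))))

  private
    conj-hook⇒column : ∀ {v} → IsFirstColumnHook (conj μ) v → ∃[ c ] c < m × v + suc c ≡ #parts> c μ + m
    conj-hook⇒column (c , c< , eq) = c , c<m , trans eq (cong₂ _+_ (conj-at μ-dec c<m) (conj-length μ-dec))
      where
      c<m : c < m
      c<m = subst (c <_) (conj-length μ-dec) c<

    column⇒conj-hook : ∀ {v c} → c < m → v + suc c ≡ #parts> c μ + m → IsFirstColumnHook (conj μ) v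
    column⇒conj-hook {c = c} c<m eq =
      c , subst (c <_) (sym (conj-length μ-dec)) c<m , trans eq (sym (cong₂ _+_ (conj-at μ-dec c<m) (conj-length μ-dec)))

  hook-bounds : ∀ {g} → IsFirstColumnHook μ g → 1 ≤ g × g ≤ M
  hook-bounds {g} (r , r<k , eq) = g≥1 , g≤M
    where
    g≥1 : 1 ≤ g
    g≥1 = ℕ.+-cancelʳ-≤ (suc r) 1 g (ℕ.≤-trans (ℕ.+-mono-≤ (at-positive (proj₁ μ-part) r<k) r<k) (ℕ.≤-reflexive (sym eq)))
    g≤M : g ≤ M
    g≤M = ℕ.+-cancelʳ-≤ (suc r) g M (begin
      g + suc r  ≡⟨ eq ⟩
      at μ r + k ≤⟨ ℕ.+-monoˡ-≤ k (μᵣ≤m r<k) ⟩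
      m + k      ≡⟨ M+1≡m+k ⟨
      M + 1      ≤⟨ ℕ.+-monoʳ-≤ M (s≤s z≤n) ⟩
      M + suc r  ∎)
      where open ℕ.≤-Reasoning

  hook-top : IsFirstColumnHook μ M
  hook-top = 0 , s≤s z≤n , M+1≡m+k

  conj-hook⇒ : ∀ {v} → IsFirstColumnHook (conj μ) v → 1 ≤ v × v ≤ M × (∀ g → v + g ≡ M → ¬ IsFirstColumnHook μ g)
  conj-hook⇒ {v} conj-hook with c , c<m , eq ← conj-hook⇒column conj-hook = v≥1 , v≤M , not-hook
    where
    v≥1 : 1 ≤ v
    v≥1 = ℕ.+-cancelʳ-≤ (suc c) 1 v (begin
      1 + suc c       ≤⟨ ℕ.+-mono-≤ (#parts>-lower μ-dec (s≤s z≤n) c<m) c<m ⟩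
      #parts> c μ + m ≡⟨ eq ⟨
      v + suc c       ∎)
      where open ℕ.≤-Reasoning
    v≤M : v ≤ M
    v≤M = ℕ.+-cancelʳ-≤ 1 v M (begin
      v + 1           ≤⟨ ℕ.+-monoʳ-≤ v (s≤s z≤n) ⟩
      v + suc c       ≡⟨ eq ⟩
      #parts> c μ + m ≤⟨ ℕ.+-monoˡ-≤ m (#parts>≤length c μ) ⟩
      k + m           ≡⟨ ℕ.+-comm k m ⟩
      m + k           ≡⟨ M+1≡m+k ⟨
      M + 1           ∎)
      where open ℕ.≤-Reasoning
    not-hook : ∀ g → v + g ≡ M → ¬ IsFirstColumnHook μ g
    not-hook g v+g≡M hook = hook-cohook-disjoint hook (c , c<m , ℕ.+-cancelʳ-≡ m _ _ (begin
      g + #parts> c μ + m   ≡⟨ lemma₁ g (#parts> c μ) m ⟩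
      g + (#parts> c μ + m) ≡⟨ cong (_+_ g) eq ⟨
      g + (v + suc c)       ≡⟨ lemma₂ g v c ⟩
      (v + g) + 1 + c       ≡⟨ cong (λ x → x + 1 + c) v+g≡M ⟩
      M + 1 + c             ≡⟨ cong (_+ c) M+1≡m+k ⟩
      m + k + c             ≡⟨ lemma₃ m k c ⟩
      c + k + m             ∎))
      where
      open ≡-Reasoning
      lemma₁ : ∀ g x m → g + x + m ≡ g + (x + m)
      lemma₁ = ℕ-solve-∀
      lemma₂ : ∀ g v c → g + (v + suc c) ≡ (v + g) + 1 + c
      lemma₂ = ℕ-solve-∀
      lemma₃ : ∀ m k c → m + k + c ≡ c + k + m
      lemma₃ = ℕ-solve-∀

  conj-hook⇐ : ∀ {v} → v ≤ M → (∀ g → v + g ≡ M → ¬ IsFirstColumnHook μ g) → IsFirstColumnHook (conj μ) v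
  conj-hook⇐ {v} v≤M not-hook
    with c , c<m , eq ← hook-cohook-cover (ℕ.m∸n≤m M v) (not-hook (M ∸ v) (ℕ.m+[n∸m]≡n v≤M))
    = column⇒conj-hook c<m (ℕ.+-cancelʳ-≡ (M ∸ v) _ _ (begin
      v + suc c + g         ≡⟨ lemma₁ v c g ⟩
      (v + g) + 1 + c       ≡⟨ cong (λ x → x + 1 + c) (ℕ.m+[n∸m]≡n v≤M) ⟩
      M + 1 + c             ≡⟨ cong (_+ c) M+1≡m+k ⟩
      m + k + c             ≡⟨ lemma₂ m k c ⟩
      m + (c + k)           ≡⟨ cong (_+_ m) eq ⟨
      m + (g + #parts> c μ) ≡⟨ lemma₃ (#parts> c μ) m g ⟩
      #parts> c μ + m + g   ∎))
    where
    open ≡-Reasoning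
    g = M ∸ v
    lemma₁ : ∀ v c g → v + suc c + g ≡ (v + g) + 1 + c
    lemma₁ = ℕ-solve-∀
    lemma₂ : ∀ m k c → m + k + c ≡ m + (c + k)
    lemma₂ = ℕ-solve-∀
    lemma₃ : ∀ x m g → m + (g + x) ≡ x + m + g
    lemma₃ = ℕ-solve-∀

-- Complementary hook sets

record Complementary (M : ℤ) (A B : List ℤ) : Set where
  field
    A-bounded : ∀ {h} → h ∈ A → + 1 ℤ.≤ h × h ℤ.≤ M
    B-members : ∀ {h} → h ∈ B ⇔ ((+ 1 ℤ.≤ h × h ℤ.≤ M) × M - h ∉ A)
    A-top     : M ∈ A ⊎ M ≡ ℤ.-1ℤ

module _ {M : ℤ} {A B : List ℤ} (A∁B : Complementary M A B) where
  open Complementary A∁B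

  private
    M≥-1 : ℤ.-1ℤ ℤ.≤ M
    M≥-1 with A-top
    ... | inj₁ M∈A  = ℤ.≤-trans (ℤ.-≤+ {0} {1}) (proj₁ (A-bounded M∈A))
    ... | inj₂ refl = ℤ.≤-refl

    M-[M-h]≡h : ∀ h → M - (M - h) ≡ h
    M-[M-h]≡h = lemma M
      where
      lemma : ∀ M h → M - (M - h) ≡ h
      lemma = solve-∀

  Complementary-sym : Complementary M B A
  Complementary-sym = record
    { A-bounded = proj₁ ∘ Equivalence.to B-members
    ; B-members = mk⇔ A⇒ A⇐
    ; A-top     = B-top
    }
    where
    A⇒ : ∀ {h} → h ∈ A → (+ 1 ℤ.≤ h × h ℤ.≤ M) × M - h ∉ B
    A⇒ {h} h∈A = A-bounded h∈A , λ M-h∈B → proj₂ (Equivalence.to B-members M-h∈B) (subst (_∈ A) (sym (M-[M-h]≡h h)) h∈A)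
    A⇐ : ∀ {h} → (+ 1 ℤ.≤ h × h ℤ.≤ M) × M - h ∉ B → h ∈ A
    A⇐ {h} ((1≤h , h≤M) , M-h∉B) with h ∈? A | h ℤ.<? M | A-top
    ... | yes h∈A | _       | _         = h∈A
    ... | no  h∉A | yes h<M | _         =
      contradiction (Equivalence.from B-members ((1≤M-h , M-h≤M) , subst (_∉ A) (sym (M-[M-h]≡h h)) h∉A)) M-h∉B
      where
      1≤M-h : + 1 ℤ.≤ M - h
      1≤M-h = ℤ.i<j⇒suc[i]≤j (<⇒0<-diff h<M)
      M-h≤M : M - h ℤ.≤ M
      M-h≤M = ℤ.i-j≤i M h {{ℤ.nonNegative (ℤ.≤-trans (ℤ.+≤+ z≤n) 1≤h)}}
    ... | no  h∉A | no  h≮M | inj₁ M∈A  = contradiction (subst (_∈ A) (ℤ.≤-antisym (ℤ.≮⇒≥ h≮M) h≤M) M∈A) h∉A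
    ... | no  h∉A | no  h≮M | inj₂ refl = contradiction (ℤ.≤-trans 1≤h h≤M) (λ ())
    B-top : M ∈ B ⊎ M ≡ ℤ.-1ℤ
    B-top with A-top
    ... | inj₂ M≡-1 = inj₂ M≡-1
    ... | inj₁ M∈A  = inj₁ (Equivalence.from B-members ((proj₁ (A-bounded M∈A) , ℤ.≤-refl) , M-M∉A))
      where
      M-M∉A : M - M ∉ A
      M-M∉A M-M∈A = contradiction (proj₁ (A-bounded (subst (_∈ A) (ℤ.+-inverseʳ M) M-M∈A))) λ { (ℤ.+≤+ ()) }

  generator-reflect : ∀ {n z} → IsGenerator n B z → IsGenerator n A (M ℤ.+ + n - z)
  generator-reflect {n} {z} (z≥0 , z∉B , predecessor) = proj₁ (g-outside predecessor) , proj₂ (g-outside predecessor) , g-predecessor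
    where
    g = M ℤ.+ + n - z
    g-outside : z ℤ.< + n ⊎ z - + n ∈ B → + 0 ℤ.≤ g × g ∉ A
    g-outside (inj₁ z<n) = ℤ.i<j⇒suc[i]≤j (ℤ.≤-<-trans M≥-1 M<g) , λ g∈A → ℤ.<⇒≱ M<g (proj₂ (A-bounded g∈A))
      where
      lemma : ∀ M n z → (M ℤ.+ n - z) - M ≡ n - z
      lemma = solve-∀
      M<g : M ℤ.< g
      M<g = <-from-diff z<n (lemma M (+ n) z)
    g-outside (inj₂ z-n∈B) with (_ , z-n≤M) , M-[z-n]∉A ← Equivalence.to B-members z-n∈B =
      subst (+ 0 ℤ.≤_) g≡ (ℤ.i≤j⇒0≤j-i z-n≤M) , subst (_∉ A) g≡ M-[z-n]∉A
      where
      lemma : ∀ M n z → M - (z - n) ≡ M ℤ.+ n - z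
      lemma = solve-∀
      g≡ : M - (z - + n) ≡ g
      g≡ = lemma M (+ n) z
    g-n≡M-z : g - + n ≡ M - z
    g-n≡M-z = lemma M (+ n) z
      where
      lemma : ∀ M n z → (M ℤ.+ n - z) - n ≡ M - z
      lemma = solve-∀
    g-predecessor : g ℤ.< + n ⊎ g - + n ∈ A
    g-predecessor with + 0 ℤ.<? z
    g-predecessor | no z≯0 with refl ← ℤ.≤-antisym (ℤ.≮⇒≥ z≯0) z≥0 with A-top
    ... | inj₁ M∈A  = inj₂ (subst (_∈ A) (trans (sym (ℤ.+-identityʳ M)) (sym g-n≡M-z)) M∈A)
    ... | inj₂ refl = inj₁ (<-from-diff (ℤ.+<+ (s≤s z≤n)) (lemma (+ n)))
      where
      lemma : ∀ n → n - (ℤ.- + 1 ℤ.+ n - + 0) ≡ + 1 - + 0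
      lemma = solve-∀
    g-predecessor | yes z>0 with z ℤ.≤? M
    ... | no z≰M = inj₁ (<-from-diff (ℤ.≰⇒> z≰M) (lemma M (+ n) z))
      where
      lemma : ∀ M n z → n - (M ℤ.+ n - z) ≡ z - M
      lemma = solve-∀
    ... | yes z≤M with M - z ∈? A
    ...   | yes M-z∈A = inj₂ (subst (_∈ A) (sym g-n≡M-z) M-z∈A)
    ...   | no  M-z∉A = contradiction (Equivalence.from B-members ((ℤ.i<j⇒suc[i]≤j z>0 , z≤M) , M-z∉A)) z∉B

generator-reflect⇔ : ∀ {M A B n z} → Complementary M A B → IsGenerator n B z ⇔ IsGenerator n A (M ℤ.+ + n - z)
generator-reflect⇔ {M} {n = n} {z} A∁B = mk⇔ (generator-reflect A∁B)
  (subst (IsGenerator n _) (lemma (M ℤ.+ + n) z) ∘ generator-reflect (Complementary-sym A∁B))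
  where
  lemma : ∀ c z → c - (c - z) ≡ z
  lemma = solve-∀

Complementary-resp : ∀ {M A A′ B B′} → (∀ {h} → h ∈ A ⇔ h ∈ A′) → (∀ {h} → h ∈ B ⇔ h ∈ B′) →
                     Complementary M A B → Complementary M A′ B′
Complementary-resp A≈A′ B≈B′ A∁B = record
  { A-bounded = A-bounded ∘ Equivalence.from A≈A′
  ; B-members = mk⇔ (λ h∈B′ → let bounds , M-h∉A = Equivalence.to B-members (Equivalence.from B≈B′ h∈B′)
                               in bounds , M-h∉A ∘ Equivalence.from A≈A′)
                    (λ (bounds , M-h∉A′) → Equivalence.to B≈B′ (Equivalence.from B-members (bounds , M-h∉A′ ∘ Equivalence.to A≈A′)))
  ; A-top     = Sum.map₁ (Equivalence.to A≈A′) A-top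
  }
  where open Complementary A∁B

-- -1 for the empty partition makes the complementarity statement below uniform.
largestHook : List ℕ → ℤ
largestHook []      = ℤ.-1ℤ
largestHook (m ∷ μ) = + (m + length μ)

private
  firstColumnHooks : List ℕ → List ℤ
  firstColumnHooks μ = map +_ (firstColHooks μ)

  +-diff⇒sum : ∀ {M v g} → + M - + v ≡ + g → v + g ≡ M
  +-diff⇒sum {M} {v} {g} eq = ℤ.+-injective (begin
    + (v + g)        ≡⟨ ℤ.pos-+ v g ⟩
    + v ℤ.+ + g      ≡⟨ cong (ℤ._+_ (+ v)) eq ⟨
    + v ℤ.+ (+ M - + v) ≡⟨ lemma (+ M) (+ v) ⟩
    + M              ∎)
    where
    open ≡-Reasoning
    lemma : ∀ M v → v ℤ.+ (M - v) ≡ M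
    lemma = solve-∀

  sum⇒+-diff : ∀ {M v g} → v + g ≡ M → + g ≡ + M - + v
  sum⇒+-diff {M} {v} {g} eq = begin
    + g                 ≡⟨ lemma (+ v) (+ g) ⟩
    (+ v ℤ.+ + g) - + v ≡⟨ cong (_- + v) (trans (sym (ℤ.pos-+ v g)) (cong +_ eq)) ⟩
    + M - + v           ∎
    where
    open ≡-Reasoning
    lemma : ∀ v g → g ≡ (v ℤ.+ g) - v
    lemma = solve-∀

conj-complementary : ∀ {μ} → IsPartition μ → IsPartition (conj μ) →
                     Complementary (largestHook μ) (firstColumnHooks μ) (firstColumnHooks (conj μ))
conj-complementary {[]} _ _ = record
  { A-bounded = λ ()
  ; B-members = mk⇔ (λ ()) (λ ((1≤h , h≤-1) , _) → contradiction (ℤ.≤-trans 1≤h h≤-1) λ ())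
  ; A-top     = inj₂ refl
  }
conj-complementary {m ∷ μ′} μ-part μ′-part = record
  { A-bounded = A-bounded
  ; B-members = mk⇔ B⇒ B⇐
  ; A-top     = inj₁ (∈-firstColHooks⁺ μ-part hook-top)
  }
  where
  open FirstColumnHooks μ-part
  A-bounded : ∀ {h} → h ∈ firstColumnHooks (m ∷ μ′) → + 1 ℤ.≤ h × h ℤ.≤ + M
  A-bounded h∈ with g , refl , hook ← ∈-firstColHooks⁻ μ-part h∈ =
    let 1≤g , g≤M = hook-bounds hook in ℤ.+≤+ 1≤g , ℤ.+≤+ g≤M
  B⇒ : ∀ {h} → h ∈ firstColumnHooks (conj (m ∷ μ′)) → (+ 1 ℤ.≤ h × h ℤ.≤ + M) × + M - h ∉ firstColumnHooks (m ∷ μ′)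
  B⇒ h∈ with v , refl , conj-hook ← ∈-firstColHooks⁻ μ′-part h∈ with 1≤v , v≤M , not-hook ← conj-hook⇒ conj-hook =
    (ℤ.+≤+ 1≤v , ℤ.+≤+ v≤M) ,
    λ M-v∈ → let g , M-v≡g , hook = ∈-firstColHooks⁻ μ-part M-v∈ in not-hook g (+-diff⇒sum M-v≡g) hook
  B⇐ : ∀ {h} → (+ 1 ℤ.≤ h × h ℤ.≤ + M) × + M - h ∉ firstColumnHooks (m ∷ μ′) → h ∈ firstColumnHooks (conj (m ∷ μ′))
  B⇐ {+ v} ((_ , ℤ.+≤+ v≤M) , M-v∉) = ∈-firstColHooks⁺ μ′-part (conj-hook⇐ v≤M not-hook)
    where
    not-hook : ∀ g → v + g ≡ M → ¬ IsFirstColumnHook (m ∷ μ′) g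
    not-hook g v+g≡M hook = M-v∉ (subst (_∈ firstColumnHooks (m ∷ μ′)) (sum⇒+-diff v+g≡M) (∈-firstColHooks⁺ μ-part hook))

-- Reflection of the North labels

module Reflection {n p : ℕ} {{_ : ℕ.NonZero n}} {{_ : ℕ.NonZero p}} (n⊥p : Coprime n p)
                  {x y : List Step} (x-dyck : IsRatDyck n p x) (y-dyck : IsRatDyck n p y)
                  {M : ℤ} (Hx∁Hy : Complementary M (H n p x) (H n p y)) where

  private
    module X = DyckPath n⊥p x-dyck
    module Y = DyckPath n⊥p y-dyck

  c : ℤ
  c = M ℤ.+ + n

  private
    c-[c-z]≡z : ∀ z → c - (c - z) ≡ z
    c-[c-z]≡z = lemma c
      where
      lemma : ∀ c z → c - (c - z) ≡ z
      lemma = solve-∀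

  NL-reflect : ∀ {z} → z ∈ Y.NL ⇔ c - z ∈ X.NL
  NL-reflect = mk⇔ (X.generator⇒NL ∘ Equivalence.to (generator-reflect⇔ Hx∁Hy) ∘ Y.NL⇒generator)
                   (Y.generator⇒NL ∘ Equivalence.from (generator-reflect⇔ Hx∁Hy) ∘ X.NL⇒generator)

  northLabels-reflect : northLabels n p y ≡ reverse (map (c -_) (northLabels n p x))
  northLabels-reflect = sorted-↭⇒≡ (sort-↗ Y.NL) reflected-sorted (begin
    sort Y.NL                               ↭⟨ sort-↭ Y.NL ⟩
    Y.NL                                    ↭⟨ unique-set⇒↭ Y.NL-unique reflected-unique (mk⇔ to from) ⟩
    map (c -_) X.NL                         ↭⟨ ↭-map⁺ (c -_) (↭-sym (sort-↭ X.NL)) ⟩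
    map (c -_) (sort X.NL)                  ↭⟨ ↭-reverse (map (c -_) (sort X.NL)) ⟨
    reverse (map (c -_) (sort X.NL))        ∎)
    where
    open PermutationReasoning
    reflected-sorted : Sorted (reverse (map (c -_) (sort X.NL)))
    reflected-sorted = AllPairs⇒Sorted ℤ.≤-totalOrder (AllPairs-reverse⁺ (AllPairs.map⁺
      (AllPairs.map (λ u≤v → ℤ.+-monoʳ-≤ c (ℤ.neg-mono-≤ u≤v)) (Sorted⇒AllPairs ℤ.≤-totalOrder (sort-↗ X.NL)))))
    reflected-unique : Unique (map (c -_) X.NL)
    reflected-unique = Unique.map⁺ (λ {u} {v} eq → trans (sym (c-[c-z]≡z u)) (trans (cong (c -_) eq) (c-[c-z]≡z v))) X.NL-unique
    to : ∀ {z} → z ∈ Y.NL → z ∈ map (c -_) X.NL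
    to {z} z∈ = subst (_∈ map (c -_) X.NL) (c-[c-z]≡z z) (∈-map⁺ (c -_) (Equivalence.to NL-reflect z∈))
    from : ∀ {z} → z ∈ map (c -_) X.NL → z ∈ Y.NL
    from z∈ with u , u∈ , refl ← ∈-map⁻ (c -_) z∈ = Equivalence.from NL-reflect (subst (_∈ X.NL) (sym (c-[c-z]≡z u)) u∈)

  NL-reflect⁻¹ : ∀ {z} → z ∈ X.NL → c - z ∈ Y.NL
  NL-reflect⁻¹ {z} z∈ = Equivalence.from NL-reflect (subst (_∈ X.NL) (sym (c-[c-z]≡z z)) z∈)

  ℓ-reflect : ∀ {k} → 1 ≤ k → k ≤ n → ℓ n p y (n + 1 ∸ k) ≡ c - ℓ n p x k
  ℓ-reflect {suc k} _ k<n = begin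
    atℤ (northLabels n p y) (n + 1 ∸ suc k)          ≡⟨ cong₂ atℤ northLabels-reflect index≡ ⟩
    atℤ (reverse (map (c -_) (northLabels n p x))) (suc i) ≡⟨ atℤ-reverse (map (c -_) (northLabels n p x)) i+k+1≡ ⟩
    atℤ (map (c -_) (northLabels n p x)) (suc k)     ≡⟨ atℤ-map (c -_) (northLabels n p x) (subst (k <_) (sym X.northLabels-length) k<n) ⟩
    c - atℤ (northLabels n p x) (suc k)              ∎
    where
    open ≡-Reasoning
    i = n ∸ suc k
    index≡ : n + 1 ∸ suc k ≡ suc i
    index≡ = trans (ℕ.+-∸-comm 1 k<n) (ℕ.+-comm i 1)
    i+k+1≡ : suc (i + k) ≡ length (map (c -_) (northLabels n p x))
    i+k+1≡ = trans (sym (ℕ.+-suc i k)) (trans (ℕ.m∸n+n≡m k<n)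
               (sym (trans (List.length-map (c -_) (northLabels n p x)) X.northLabels-length)))

  codinv-transpose : ∀ {i j} → 1 ≤ i → i < j → j ≤ n → d n p y (n + 1 ∸ j) (n + 1 ∸ i) ≡ d n p x i j
  codinv-transpose {i} {j} 1≤i i<j j≤n = begin
    d n p y (n + 1 ∸ j) (n + 1 ∸ i)                             ≡⟨ cong₂ (λ a b → length (filterᵇ (codinvCond n p a b) (H n p y)))
                                                                         (ℓ-reflect 1≤j j≤n) (ℓ-reflect 1≤i i≤n) ⟩
    length (filterᵇ (codinvCond n p (c - β) (c - α)) (H n p y)) ≡⟨ Y.codinv-count (NL-reflect⁻¹ β∈) (NL-reflect⁻¹ α∈) [c-α]-[c-β]≡δ ⟩
    length (codinvIndices n p δ)                                ≡⟨ X.codinv-count α∈ β∈ β-α≡δ ⟨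
    d n p x i j                                                 ∎
    where
    open ≡-Reasoning
    1≤j = ℕ.≤-trans 1≤i (ℕ.<⇒≤ i<j)
    i≤n = ℕ.≤-trans (ℕ.<⇒≤ i<j) j≤n
    α = ℓ n p x i
    β = ℓ n p x j
    α∈ = X.ℓ-∈ 1≤i i≤n
    β∈ = X.ℓ-∈ 1≤j j≤n
    δ = ℤ.∣ β - α ∣
    β-α≡δ : β - α ≡ + δ
    β-α≡δ = sym (ℤ.0≤i⇒+∣i∣≡i (ℤ.i≤j⇒0≤j-i (X.ℓ-mono 1≤i (ℕ.<⇒≤ i<j) j≤n)))
    [c-α]-[c-β]≡δ : (c - α) - (c - β) ≡ + δ
    [c-α]-[c-β]≡δ = trans (lemma c α β) β-α≡δ
      where
      lemma : ∀ c α β → (c - α) - (c - β) ≡ β - α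
      lemma = solve-∀

corollary3p3 : (n p : ℕ) → 0 < n → 0 < p → Coprime n p →
    (x y : List Step) → IsRatDyck n p x → IsRatDyck n p y →
    (λx : List ℕ) → Φ n p x λx → Φ n p y (conj λx) →
    (i j : ℕ) → 1 ≤ i → i < j → j ≤ n →
    d n p y (n + 1 ∸ j) (n + 1 ∸ i) ≡ d n p x i j
corollary3p3 n p 0<n 0<p n⊥p x y x-dyck y-dyck λx Φx Φy i j =
  Reflection.codinv-transpose n⊥p x-dyck y-dyck Hx∁Hy
  where
  instance
    n≢0 : ℕ.NonZero n
    n≢0 = ℕ.>-nonZero 0<n
    p≢0 : ℕ.NonZero p
    p≢0 = ℕ.>-nonZero 0<p
  Hx∁Hy : Complementary (largestHook λx) (H n p x) (H n p y)
  Hx∁Hy = Complementary-resp (λ {h} → proj₂ Φx h) (λ {h} → proj₂ Φy h) (conj-complementary (proj₁ Φx) (proj₁ Φy))
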